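{- Let $r$ be a positive integer, let $n$ be a non-negative integer, and let $b$ be a complex number that is not an integer. Then $$ F(-2n,\, b,\, -2n+2r-b,\, -1)= \frac{\left(\tfrac{1}{2}\right)_n\,(b+1-r)_n}{\left(\tfrac{b}{2}+1-r\right)_n\left(\tfrac{b}{2}+\tfrac{1}{2}-r\right)_n} \cdot \sum_{i=0}^{r-1} \frac{2^{2i}\, i!\, \binom{r+i-1}{2i}}{(b-r+1)_i}\binom{n}{i}. $$
   Context: For a complex number $z$ and a non-negative integer $k$, $(z)_k := z(z+1)(z+2)\cdots(z+k-1)$ denotes the rising factorial, with $(z)_0=1$. For a non-negative integer $m$ and complex $b,c,x$ with $(c)_k\neq 0$ for $0\le k\le m$, the terminating hypergeometric series is $$F(-m,\, b,\, c,\, x) := \sum_{k=0}^{m} \frac{(-m)_k\,(b)_k}{k!\,(c)_k}\,x^k .$$ For $b$ not an integer, all denominators appearing in the identity are nonzero. -}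

module Defs where

open import Level using (_⊔_) renaming (suc to lsuc)
open import Data.Nat using (ℕ; zero; suc)
open import Data.Nat.Combinatorics using (_C_)
open import Data.Nat using (_!)
open import Relation.Nullary using (¬_)
open import Algebra.Bundles using (CommutativeRing)

ringFromℕ : ∀ {c ℓ} (R : CommutativeRing c ℓ) → ℕ → CommutativeRing.Carrier R
ringFromℕ R zero    = CommutativeRing.0# R
ringFromℕ R (suc n) = CommutativeRing._+_ R (CommutativeRing.1# R) (ringFromℕ R n)

record CharZeroField (c ℓ : Level.Level) : Set (lsuc (c ⊔ ℓ)) where
  field
    commutativeRing : CommutativeRing c ℓ
    _⁻¹      : CommutativeRing.Carrier commutativeRing → CommutativeRing.Carrier commutativeRing
    ⁻¹-inverse : let open CommutativeRing commutativeRing in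
                 ∀ x → ¬ (x ≈ 0#) → x * (x ⁻¹) ≈ 1#
    char0    : let open CommutativeRing commutativeRing in
               ∀ n → ¬ (ringFromℕ commutativeRing (suc n) ≈ 0#)
  open CommutativeRing commutativeRing public

  fromℕ : ℕ → Carrier
  fromℕ = ringFromℕ commutativeRing

module FieldOps {c ℓ} (K : CharZeroField c ℓ) where
  open CharZeroField K

  infixl 7 _/_
  _/_ : Carrier → Carrier → Carrier
  x / y = x * (y ⁻¹)

  pow : Carrier → ℕ → Carrier
  pow x zero    = 1#
  pow x (suc k) = pow x k * x

  rising : Carrier → ℕ → Carrier
  rising z zero    = 1#
  rising z (suc k) = rising z k * (z + fromℕ k)

  sumTo : ℕ → (ℕ → Carrier) → Carrier
  sumTo zero    f = f 0
  sumTo (suc m) f = sumTo m f + f (suc m)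

  NotInteger : Carrier → Set ℓ
  NotInteger b = ∀ m → ¬ (b ≈ fromℕ m) × ¬ (b ≈ - fromℕ m)
    where open import Data.Product using (_×_)

  F : ℕ → Carrier → Carrier → Carrier → Carrier
  F m b c' x = sumTo m (λ k →
    (rising (- fromℕ m) k * rising b k) / (fromℕ (k !) * rising c' k) * pow x k)

  two half : Carrier
  two  = fromℕ 2
  half = 1# / two

module Submission where

-- Read a sequence as the coefficients of an exponential generating function: the
-- binomial convolution ⊛ is then the product and xMul is multiplication by x, while
-- altRising a and rising y are (1+x)^{-a} and (1-x)^{-y}.  Clearing denominators,
-- F(-2n, b, 1-y-2n; -1)·(y)_{2n} with y = b+1-2r is the 2n-th coefficient of
-- (1+x)^{-b}(1-x)^{-y} = (1-x)^{2r}·(1+x)^{-b}(1-x)^{-b-1}.  Kummer's observation that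
-- (1-x²)^{-a} is even, with 2n-th coefficient (2n)!/n!·(a)_n, gives the cases r = 0, 1,
-- and as (1-x)⁴ is a combination of (1-x)², x²(1-x)² and even powers of x, the even
-- coefficients satisfy a three-term recurrence in r.  Multiplied by (b+1-r)_n, the sum
-- on the right becomes the n-th coefficient of Σᵢ 4^i C(r+i-1,2i)·x^i(1-x)^{-(b+1-r+i)},
-- which satisfies the same recurrence and initial values.  Gauss' duplication formula
-- and (1/2)_n 4^n = (2n)!/n! turn the remaining factors into the stated prefactor.

open import Defs
open import Data.Nat using (ℕ; zero; suc; _!)
open import Data.Nat as N using ()
open import Data.Nat.Properties as NP using ()
open import Data.Nat.Combinatorics using (_C_; nCk+nC[k+1]≡[n+1]C[k+1]; k>n⇒nCk≡0)
open import Data.Integer as Z using (ℤ; +_; -[1+_])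
open import Data.Integer.Properties as ZP using ()
open import Data.Sign as Sign using (Sign)
open import Data.Maybe as Maybe using (Maybe)
open import Data.Product using (_×_; _,_; proj₁; proj₂)
open import Data.Sum using (inj₁; inj₂)
open import Relation.Nullary using (¬_)
open import Relation.Binary.PropositionalEquality as P using (_≡_)
open import Relation.Binary.Consequences using (dec⇒weaklyDec)
import Algebra.Solver.Ring.AlmostCommutativeRing as ACR
import Algebra.Solver.Ring as RingSolver

double : ℕ → ℕ
double zero    = zero
double (suc n) = suc (suc (double n))

2*suc : ∀ i → 2 N.* suc i ≡ suc (suc (2 N.* i))
2*suc i = P.cong suc (NP.+-suc i (i N.+ 0))

double≡2* : ∀ n → double n ≡ 2 N.* n
double≡2* zero    = P.refl
double≡2* (suc n) = P.trans (P.cong (λ t → suc (suc t)) (double≡2* n)) (P.sym (2*suc n))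

C-second-difference : ∀ N k → suc (suc N) C suc (suc k) N.+ N C suc (suc k)
                              ≡ suc N C suc (suc k) N.+ suc N C suc (suc k) N.+ N C k
C-second-difference N k = begin
  suc (suc N) C suc (suc k) N.+ N C suc (suc k)
    ≡⟨ P.cong (N._+ N C suc (suc k)) (P.sym (pascal (suc N) (suc k))) ⟩
  (suc N C suc k N.+ suc N C suc (suc k)) N.+ N C suc (suc k)
    ≡⟨ P.cong₂ (λ x y → (x N.+ y) N.+ N C suc (suc k)) (P.sym (pascal N k)) (P.sym (pascal N (suc k))) ⟩
  ((N C k N.+ N C suc k) N.+ (N C suc k N.+ N C suc (suc k))) N.+ N C suc (suc k)
    ≡⟨ ℕ-solve 3 (λ a b c → ((a ℕ:+ b) ℕ:+ (b ℕ:+ c)) ℕ:+ c ℕ:= ((b ℕ:+ c) ℕ:+ (b ℕ:+ c)) ℕ:+ a) P.refl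
                 (N C k) (N C suc k) (N C suc (suc k)) ⟩
  ((N C suc k N.+ N C suc (suc k)) N.+ (N C suc k N.+ N C suc (suc k))) N.+ N C k
    ≡⟨ P.cong₂ (λ x y → (x N.+ y) N.+ N C k) (pascal N (suc k)) (pascal N (suc k)) ⟩
  suc N C suc (suc k) N.+ suc N C suc (suc k) N.+ N C k ∎
  where
  open P.≡-Reasoning
  open import Data.Nat.Solver using (module +-*-Solver)
  open +-*-Solver using () renaming (solve to ℕ-solve; _:+_ to _ℕ:+_; _:=_ to _ℕ:=_)
  pascal : ∀ n k → n C k N.+ n C suc k ≡ suc n C suc k
  pascal = nCk+nC[k+1]≡[n+1]C[k+1]

module _ {c ℓ} (K : CharZeroField c ℓ) where
  open CharZeroField K hiding (zero)
  open FieldOps K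
  open import Relation.Binary.Reasoning.Setoid setoid
  open import Algebra.Properties.Ring ring
    using (-‿involutive; -0#≈0#; -‿distribˡ-*; -‿distribʳ-*; -‿+-comm)

  fromℕ-+ : ∀ m n → fromℕ (m N.+ n) ≈ fromℕ m + fromℕ n
  fromℕ-+ zero    n = sym (+-identityˡ _)
  fromℕ-+ (suc m) n = trans (+-congˡ (fromℕ-+ m n)) (sym (+-assoc _ _ _))

  fromℕ-* : ∀ m n → fromℕ (m N.* n) ≈ fromℕ m * fromℕ n
  fromℕ-* zero    n = sym (zeroˡ _)
  fromℕ-* (suc m) n = begin
    fromℕ (n N.+ m N.* n)           ≈⟨ fromℕ-+ n (m N.* n) ⟩
    fromℕ n + fromℕ (m N.* n)       ≈⟨ +-congˡ (fromℕ-* m n) ⟩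
    fromℕ n + fromℕ m * fromℕ n     ≈⟨ +-congʳ (sym (*-identityˡ _)) ⟩
    1# * fromℕ n + fromℕ m * fromℕ n ≈⟨ sym (distribʳ _ _ _) ⟩
    (1# + fromℕ m) * fromℕ n        ∎

  fromℕ-∸ : ∀ {m n} → n N.≤ m → fromℕ m ≈ fromℕ (m N.∸ n) + fromℕ n
  fromℕ-∸ {m} {n} n≤m = trans (reflexive (P.cong fromℕ (P.sym (NP.m∸n+n≡m n≤m)))) (fromℕ-+ (m N.∸ n) n)

  -- The literals are sent to
  -- 1#, 1# + 1#, … rather than to fromℕ n = 1# + (… + 0#), so that the
  -- solver's constants match the terms in goals up to definitional equality.
  literal : ℕ → Carrier
  literal zero          = 0#
  literal (suc zero)    = 1#
  literal (suc (suc n)) = 1# + literal (suc n)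

  literal≈fromℕ : ∀ n → literal n ≈ fromℕ n
  literal≈fromℕ zero          = refl
  literal≈fromℕ (suc zero)    = sym (+-identityʳ _)
  literal≈fromℕ (suc (suc n)) = +-congˡ (literal≈fromℕ (suc n))

  signed : Sign → Carrier → Carrier
  signed Sign.+ x = x
  signed Sign.- x = - x

  signed-cong : ∀ s {x y} → x ≈ y → signed s x ≈ signed s y
  signed-cong Sign.+ x≈y = x≈y
  signed-cong Sign.- x≈y = -‿cong x≈y

  signed-* : ∀ s t x y → signed (s Sign.* t) (x * y) ≈ signed s x * signed t y
  signed-* Sign.+ Sign.+ x y = refl
  signed-* Sign.+ Sign.- x y = -‿distribʳ-* x y
  signed-* Sign.- Sign.+ x y = -‿distribˡ-* x y
  signed-* Sign.- Sign.- x y = begin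
    x * y             ≈⟨ sym (-‿involutive _) ⟩
    - - (x * y)       ≈⟨ -‿cong (-‿distribʳ-* x y) ⟩
    - (x * - y)       ≈⟨ -‿distribˡ-* x (- y) ⟩
    - x * - y         ∎

  fromℤ : ℤ → Carrier
  fromℤ i = signed (Z.sign i) (fromℕ Z.∣ i ∣)

  fromℤ-◃ : ∀ s n → fromℤ (s Z.◃ n) ≈ signed s (fromℕ n)
  fromℤ-◃ Sign.+ zero    = refl
  fromℤ-◃ Sign.- zero    = sym -0#≈0#
  fromℤ-◃ Sign.+ (suc n) = refl
  fromℤ-◃ Sign.- (suc n) = refl

  fromℤ-* : ∀ i j → fromℤ (i Z.* j) ≈ fromℤ i * fromℤ j
  fromℤ-* i j = begin
    fromℤ (i Z.* j)                                  ≈⟨ fromℤ-◃ (s Sign.* t) (Z.∣ i ∣ N.* Z.∣ j ∣) ⟩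
    signed (s Sign.* t) (fromℕ (Z.∣ i ∣ N.* Z.∣ j ∣)) ≈⟨ signed-cong (s Sign.* t) (fromℕ-* Z.∣ i ∣ Z.∣ j ∣) ⟩
    signed (s Sign.* t) (fromℕ Z.∣ i ∣ * fromℕ Z.∣ j ∣) ≈⟨ signed-* s t _ _ ⟩
    fromℤ i * fromℤ j                                ∎
    where s = Z.sign i; t = Z.sign j

  fromℤ-⊖ : ∀ m n → fromℤ (m Z.⊖ n) ≈ fromℕ m + - fromℕ n
  fromℤ-⊖ zero    zero    = sym (trans (+-congˡ -0#≈0#) (+-identityʳ _))
  fromℤ-⊖ (suc m) zero    = sym (trans (+-congˡ -0#≈0#) (+-identityʳ _))
  fromℤ-⊖ zero    (suc n) = sym (+-identityˡ _)
  fromℤ-⊖ (suc m) (suc n) = begin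
    fromℤ (suc m Z.⊖ suc n)                ≡⟨ P.cong fromℤ (ZP.[1+m]⊖[1+n]≡m⊖n m n) ⟩
    fromℤ (m Z.⊖ n)                        ≈⟨ fromℤ-⊖ m n ⟩
    fromℕ m + - fromℕ n                    ≈⟨ sym (+-identityˡ _) ⟩
    0# + (fromℕ m + - fromℕ n)             ≈⟨ +-congʳ (sym (-‿inverseʳ 1#)) ⟩
    (1# + - 1#) + (fromℕ m + - fromℕ n)    ≈⟨ +-assoc _ _ _ ⟩
    1# + (- 1# + (fromℕ m + - fromℕ n))    ≈⟨ +-congˡ (trans (sym (+-assoc _ _ _)) (trans (+-congʳ (+-comm _ _)) (+-assoc _ _ _))) ⟩
    1# + (fromℕ m + (- 1# + - fromℕ n))    ≈⟨ sym (+-assoc _ _ _) ⟩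
    (1# + fromℕ m) + (- 1# + - fromℕ n)    ≈⟨ +-congˡ (-‿+-comm 1# (fromℕ n)) ⟩
    (1# + fromℕ m) + - (1# + fromℕ n)      ∎

  fromℤ-+ : ∀ i j → fromℤ (i Z.+ j) ≈ fromℤ i + fromℤ j
  fromℤ-+ -[1+ m ] -[1+ n ] = begin
    - (1# + (1# + fromℕ (m N.+ n)))      ≈⟨ -‿cong (+-congˡ (+-congˡ (fromℕ-+ m n))) ⟩
    - (1# + (1# + (fromℕ m + fromℕ n)))  ≈⟨ -‿cong (+-congˡ (trans (sym (+-assoc _ _ _)) (trans (+-congʳ (+-comm _ _)) (+-assoc _ _ _)))) ⟩
    - (1# + (fromℕ m + (1# + fromℕ n)))  ≈⟨ -‿cong (sym (+-assoc _ _ _)) ⟩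
    - ((1# + fromℕ m) + (1# + fromℕ n))  ≈⟨ sym (-‿+-comm _ _) ⟩
    - (1# + fromℕ m) + - (1# + fromℕ n)  ∎
  fromℤ-+ -[1+ m ] (+ n)    = trans (fromℤ-⊖ n (suc m)) (+-comm _ _)
  fromℤ-+ (+ m)    -[1+ n ] = fromℤ-⊖ m (suc n)
  fromℤ-+ (+ m)    (+ n)    = fromℕ-+ m n

  fromℤ-neg : ∀ i → fromℤ (Z.- i) ≈ - fromℤ i
  fromℤ-neg -[1+ n ]  = sym (-‿involutive _)
  fromℤ-neg (+ zero)  = sym -0#≈0#
  fromℤ-neg (+ suc n) = refl

  fromℤ′ : ℤ → Carrier
  fromℤ′ i = signed (Z.sign i) (literal Z.∣ i ∣)

  fromℤ′≈fromℤ : ∀ i → fromℤ′ i ≈ fromℤ i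
  fromℤ′≈fromℤ i = signed-cong (Z.sign i) (literal≈fromℕ Z.∣ i ∣)

  fromℤ′-morphism : Z.+-*-rawRing ACR.-Raw-AlmostCommutative⟶ ACR.fromCommutativeRing commutativeRing
  fromℤ′-morphism = record
    { ⟦_⟧    = fromℤ′
    ; +-homo = λ i j → homo (i Z.+ j) (fromℤ-+ i j) (+-cong (fromℤ′≈fromℤ i) (fromℤ′≈fromℤ j))
    ; *-homo = λ i j → homo (i Z.* j) (fromℤ-* i j) (*-cong (fromℤ′≈fromℤ i) (fromℤ′≈fromℤ j))
    ; -‿homo = λ i → homo (Z.- i) (fromℤ-neg i) (-‿cong (fromℤ′≈fromℤ i))
    ; 0-homo = refl
    ; 1-homo = refl
    }
    where
    homo : ∀ i {x y} → fromℤ i ≈ x → y ≈ x → fromℤ′ i ≈ y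
    homo i e₁ e₂ = trans (fromℤ′≈fromℤ i) (trans e₁ (sym e₂))

  fromℤ′-weaklyDecidable : ∀ i j → Maybe (fromℤ′ i ≈ fromℤ′ j)
  fromℤ′-weaklyDecidable i j = Maybe.map (λ { P.refl → refl }) (dec⇒weaklyDec Z._≟_ i j)

  module Solver = RingSolver Z.+-*-rawRing (ACR.fromCommutativeRing commutativeRing)
                    fromℤ′-morphism fromℤ′-weaklyDecidable
  open Solver using (solve; _:+_; _:*_; :-_; con; _:=_)

  :0 :1 :2 : ∀ {n} → Solver.Polynomial n
  :0 = con (+ 0)
  :1 = con (+ 1)
  :2 = con (+ 2)

  two≈1+1 : two ≈ 1# + 1#
  two≈1+1 = +-congˡ (+-identityʳ 1#)

  fromℕ-2* : ∀ n → fromℕ (2 N.* n) ≈ (1# + 1#) * fromℕ n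
  fromℕ-2* n = trans (fromℕ-* 2 n) (*-congʳ two≈1+1)

  1≉0 : ¬ (1# ≈ 0#)
  1≉0 1≈0 = char0 0 (trans (+-identityʳ 1#) 1≈0)

  *-≉0 : ∀ {x y} → ¬ (x ≈ 0#) → ¬ (y ≈ 0#) → ¬ (x * y ≈ 0#)
  *-≉0 {x} {y} x≉0 y≉0 xy≈0 = x≉0 (begin
    x                ≈⟨ sym (*-identityʳ x) ⟩
    x * 1#           ≈⟨ *-congˡ (sym (⁻¹-inverse y y≉0)) ⟩
    x * (y * y ⁻¹)   ≈⟨ sym (*-assoc _ _ _) ⟩
    (x * y) * y ⁻¹   ≈⟨ *-congʳ xy≈0 ⟩
    0# * y ⁻¹        ≈⟨ zeroˡ _ ⟩
    0#               ∎)

  fromℕ-!≉0 : ∀ k → ¬ (fromℕ (k !) ≈ 0#)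
  fromℕ-!≉0 k with k ! | NP.1≤n! k
  ... | suc x | _ = char0 x

  *-cancelʳ : ∀ {x u v} → ¬ (x ≈ 0#) → u * x ≈ v * x → u ≈ v
  *-cancelʳ {x} {u} {v} x≉0 ux≈vx = begin
    u               ≈⟨ sym (*-identityʳ u) ⟩
    u * 1#          ≈⟨ *-congˡ (sym (⁻¹-inverse x x≉0)) ⟩
    u * (x * x ⁻¹)  ≈⟨ sym (*-assoc _ _ _) ⟩
    (u * x) * x ⁻¹  ≈⟨ *-congʳ ux≈vx ⟩
    (v * x) * x ⁻¹  ≈⟨ *-assoc _ _ _ ⟩
    v * (x * x ⁻¹)  ≈⟨ *-congˡ (⁻¹-inverse x x≉0) ⟩
    v * 1#          ≈⟨ *-identityʳ v ⟩
    v               ∎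

  /-*-cancel : ∀ {y} → ¬ (y ≈ 0#) → ∀ x → (x / y) * y ≈ x
  /-*-cancel {y} y≉0 x = begin
    (x * y ⁻¹) * y  ≈⟨ solve 3 (λ x i y → (x :* i) :* y := x :* (y :* i)) refl x (y ⁻¹) y ⟩
    x * (y * y ⁻¹)  ≈⟨ *-congˡ (⁻¹-inverse y y≉0) ⟩
    x * 1#          ≈⟨ *-identityʳ x ⟩
    x               ∎

  half*two≈1 : half * two ≈ 1#
  half*two≈1 = /-*-cancel (char0 1) 1#

  /two*two : ∀ x → (x / two) * two ≈ x
  /two*two = /-*-cancel (char0 1)

  sumTo-cong : ∀ N {f g} → (∀ i → f i ≈ g i) → sumTo N f ≈ sumTo N g
  sumTo-cong zero    f≈g = f≈g 0
  sumTo-cong (suc N) f≈g = +-cong (sumTo-cong N f≈g) (f≈g (suc N))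

  sumTo-cong≤ : ∀ N {f g} → (∀ k → k N.≤ N → f k ≈ g k) → sumTo N f ≈ sumTo N g
  sumTo-cong≤ zero    f≈g = f≈g 0 N.z≤n
  sumTo-cong≤ (suc N) f≈g =
    +-cong (sumTo-cong≤ N (λ k k≤N → f≈g k (NP.m≤n⇒m≤1+n k≤N))) (f≈g (suc N) NP.≤-refl)

  sumTo-+ : ∀ N f g → sumTo N (λ i → f i + g i) ≈ sumTo N f + sumTo N g
  sumTo-+ zero    f g = refl
  sumTo-+ (suc N) f g = trans (+-congʳ (sumTo-+ N f g))
    (solve 4 (λ a b c d → (a :+ b) :+ (c :+ d) := (a :+ c) :+ (b :+ d)) refl _ _ _ _)

  sumTo-*ˡ : ∀ N x f → sumTo N (λ i → x * f i) ≈ x * sumTo N f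
  sumTo-*ˡ zero    x f = refl
  sumTo-*ˡ (suc N) x f = trans (+-congʳ (sumTo-*ˡ N x f)) (sym (distribˡ _ _ _))

  sumTo-*ʳ : ∀ N f x → sumTo N (λ i → f i * x) ≈ sumTo N f * x
  sumTo-*ʳ N f x = trans (sumTo-cong N (λ i → *-comm _ _)) (trans (sumTo-*ˡ N x f) (*-comm _ _))

  sumTo-suc : ∀ N f → sumTo (suc N) f ≈ f 0 + sumTo N (λ i → f (suc i))
  sumTo-suc zero    f = refl
  sumTo-suc (suc N) f = trans (+-congʳ (sumTo-suc N f)) (+-assoc _ _ _)

  sumTo-last≈0 : ∀ N f → f (suc N) ≈ 0# → sumTo (suc N) f ≈ sumTo N f
  sumTo-last≈0 N f fN≈0 = trans (+-congˡ fN≈0) (+-identityʳ _)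

  rising-cong : ∀ {z z′} → z ≈ z′ → ∀ k → rising z k ≈ rising z′ k
  rising-cong z≈z′ zero    = refl
  rising-cong z≈z′ (suc k) = *-cong (rising-cong z≈z′ k) (+-congʳ z≈z′)

  rising-suc : ∀ z k → rising z (suc k) ≈ z * rising (z + 1#) k
  rising-suc z zero    = solve 1 (λ z → :1 :* (z :+ :0) := z :* :1) refl z
  rising-suc z (suc k) = begin
    rising z (suc k) * (z + fromℕ (suc k))          ≈⟨ *-congʳ (rising-suc z k) ⟩
    z * rising (z + 1#) k * (z + (1# + fromℕ k))
      ≈⟨ solve 3 (λ z r n → z :* r :* (z :+ (:1 :+ n)) := z :* (r :* ((z :+ :1) :+ n))) refl z _ (fromℕ k) ⟩
    z * (rising (z + 1#) k * ((z + 1#) + fromℕ k))  ∎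

  rising-+ : ∀ p q z → rising z (p N.+ q) ≈ rising z p * rising (z + fromℕ p) q
  rising-+ zero    q z = trans (rising-cong (sym (+-identityʳ z)) q) (sym (*-identityˡ _))
  rising-+ (suc p) q z = begin
    rising z (suc (p N.+ q))                                   ≈⟨ rising-suc z (p N.+ q) ⟩
    z * rising (z + 1#) (p N.+ q)                              ≈⟨ *-congˡ (rising-+ p q (z + 1#)) ⟩
    z * (rising (z + 1#) p * rising ((z + 1#) + fromℕ p) q)    ≈⟨ sym (*-assoc _ _ _) ⟩
    z * rising (z + 1#) p * rising ((z + 1#) + fromℕ p) q
      ≈⟨ *-cong (sym (rising-suc z p)) (rising-cong (solve 2 (λ z p → (z :+ :1) :+ p := z :+ (:1 :+ p)) refl z (fromℕ p)) q) ⟩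
    rising z (suc p) * rising (z + fromℕ (suc p)) q            ∎

  rising-reflect : ∀ k w → rising w k ≈ pow (- 1#) k * rising (- (w + fromℕ k) + 1#) k
  rising-reflect zero    w = sym (*-identityˡ _)
  rising-reflect (suc k) w = begin
    rising w (suc k)                                                 ≈⟨ rising-suc w k ⟩
    w * rising (w + 1#) k                                            ≈⟨ *-congˡ (rising-reflect k (w + 1#)) ⟩
    w * (pow (- 1#) k * rising (- ((w + 1#) + fromℕ k) + 1#) k)      ≈⟨ *-congˡ (*-congˡ (rising-cong w+1+k k)) ⟩
    w * (pow (- 1#) k * rising w′ k)
      ≈⟨ solve 4 (λ w s R w′ → w :* (s :* R) := (s :* :- :1) :* (R :* :- w)) refl w _ _ w′ ⟩
    (pow (- 1#) k * - 1#) * (rising w′ k * - w)                      ≈⟨ *-congˡ (*-congˡ -w) ⟩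
    (pow (- 1#) k * - 1#) * (rising w′ k * (w′ + fromℕ k))           ∎
    where
    w′ = - (w + fromℕ (suc k)) + 1#
    w+1+k : - ((w + 1#) + fromℕ k) + 1# ≈ w′
    w+1+k = solve 2 (λ w n → :- ((w :+ :1) :+ n) :+ :1 := :- (w :+ (:1 :+ n)) :+ :1) refl w (fromℕ k)
    -w : - w ≈ w′ + fromℕ k
    -w = solve 2 (λ w n → :- w := (:- (w :+ (:1 :+ n)) :+ :1) :+ n) refl w (fromℕ k)

  rising≉0 : ∀ z → (∀ j → ¬ (z + fromℕ j ≈ 0#)) → ∀ k → ¬ (rising z k ≈ 0#)
  rising≉0 z z+j≉0 zero    = 1≉0
  rising≉0 z z+j≉0 (suc k) = *-≉0 (rising≉0 z z+j≉0 k) (z+j≉0 k)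

  fromℕ-pascal : ∀ m k → fromℕ (suc m C suc k) ≈ fromℕ (m C k) + fromℕ (m C suc k)
  fromℕ-pascal m k = trans (reflexive (P.cong fromℕ (P.sym (nCk+nC[k+1]≡[n+1]C[k+1] m k))))
                           (fromℕ-+ (m C k) (m C suc k))

  fromℕ-C-suc : ∀ m k → fromℕ (suc k) * fromℕ (m C suc k) ≈ fromℕ (m C k) * (fromℕ m + - fromℕ k)
  fromℕ-C-suc zero    zero    = solve 0 ((:1 :+ :0) :* :0 := (:1 :+ :0) :* (:0 :+ :- :0)) refl
  fromℕ-C-suc zero    (suc k) = solve 2 (λ x y → x :* :0 := :0 :* (:0 :+ :- y)) refl _ _
  fromℕ-C-suc (suc m) zero    = begin
    (1# + 0#) * fromℕ (suc m C 1)           ≈⟨ *-congˡ (fromℕ-pascal m 0) ⟩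
    (1# + 0#) * ((1# + 0#) + fromℕ (m C 1))
      ≈⟨ solve 1 (λ c → (:1 :+ :0) :* ((:1 :+ :0) :+ c) := :1 :+ (:1 :+ :0) :* c) refl _ ⟩
    1# + (1# + 0#) * fromℕ (m C 1)          ≈⟨ +-congˡ (fromℕ-C-suc m 0) ⟩
    1# + (1# + 0#) * (fromℕ m + - 0#)
      ≈⟨ solve 1 (λ x → :1 :+ (:1 :+ :0) :* (x :+ :- :0) := (:1 :+ :0) :* ((:1 :+ x) :+ :- :0)) refl _ ⟩
    (1# + 0#) * ((1# + fromℕ m) + - 0#)     ∎
  fromℕ-C-suc (suc m) (suc k) = begin
    fromℕ (suc (suc k)) * fromℕ (suc m C suc (suc k))  ≈⟨ *-congˡ (fromℕ-pascal m (suc k)) ⟩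
    (1# + (1# + fk)) * (A + A″)
      ≈⟨ solve 3 (λ fk A A″ → (:1 :+ (:1 :+ fk)) :* (A :+ A″) := A :+ (:1 :+ fk) :* A :+ (:1 :+ (:1 :+ fk)) :* A″) refl fk A A″ ⟩
    A + (1# + fk) * A + (1# + (1# + fk)) * A″          ≈⟨ +-cong (+-congˡ (fromℕ-C-suc m k)) (fromℕ-C-suc m (suc k)) ⟩
    A + A′ * (fm + - fk) + A * (fm + - (1# + fk))
      ≈⟨ solve 4 (λ A A′ fm fk → A :+ A′ :* (fm :+ :- fk) :+ A :* (fm :+ :- (:1 :+ fk)) := (A′ :+ A) :* ((:1 :+ fm) :+ :- (:1 :+ fk))) refl A A′ fm fk ⟩
    (A′ + A) * ((1# + fm) + - (1# + fk))               ≈⟨ *-congʳ (sym (fromℕ-pascal m k)) ⟩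
    fromℕ (suc m C suc k) * ((1# + fm) + - (1# + fk))  ∎
    where
    fk = fromℕ k
    fm = fromℕ m
    A′ = fromℕ (m C k)
    A  = fromℕ (m C suc k)
    A″ = fromℕ (m C suc (suc k))

  fromℕ-C-absorb : ∀ n i → fromℕ (suc i) * fromℕ (suc n C suc i) ≈ fromℕ (suc n) * fromℕ (n C i)
  fromℕ-C-absorb n i = begin
    fromℕ (suc i) * fromℕ (suc n C suc i)  ≈⟨ *-congˡ (fromℕ-pascal n i) ⟩
    (1# + fi) * (A + A′)                   ≈⟨ distribˡ _ _ _ ⟩
    (1# + fi) * A + (1# + fi) * A′         ≈⟨ +-congˡ (fromℕ-C-suc n i) ⟩
    (1# + fi) * A + A * (fn + - fi)
      ≈⟨ solve 3 (λ fi A fn → (:1 :+ fi) :* A :+ A :* (fn :+ :- fi) := (:1 :+ fn) :* A) refl fi A fn ⟩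
    (1# + fn) * A                          ∎
    where
    fi = fromℕ i
    fn = fromℕ n
    A  = fromℕ (n C i)
    A′ = fromℕ (n C suc i)

  rising-neg : ∀ m k → rising (- fromℕ m) k * pow (- 1#) k ≈ fromℕ (k !) * fromℕ (m C k)
  rising-neg m zero    = solve 0 (:1 :* :1 := (:1 :+ :0) :* (:1 :+ :0)) refl
  rising-neg m (suc k) = begin
    rising (- fm) k * (- fm + fk) * (pow (- 1#) k * - 1#)
      ≈⟨ solve 4 (λ R fm fk s → R :* (:- fm :+ fk) :* (s :* :- :1) := (R :* s) :* (fm :+ :- fk)) refl _ fm fk _ ⟩
    (rising (- fm) k * pow (- 1#) k) * (fm + - fk)          ≈⟨ *-congʳ (rising-neg m k) ⟩
    fromℕ (k !) * fromℕ (m C k) * (fm + - fk)               ≈⟨ *-assoc _ _ _ ⟩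
    fromℕ (k !) * (fromℕ (m C k) * (fm + - fk))             ≈⟨ *-congˡ (sym (fromℕ-C-suc m k)) ⟩
    fromℕ (k !) * (fromℕ (suc k) * fromℕ (m C suc k))
      ≈⟨ solve 3 (λ a b c → a :* (b :* c) := (b :* a) :* c) refl _ _ _ ⟩
    fromℕ (suc k) * fromℕ (k !) * fromℕ (m C suc k)         ≈⟨ *-congʳ (sym (fromℕ-* (suc k) (k !))) ⟩
    fromℕ (suc k !) * fromℕ (m C suc k)                     ∎
    where
    fm = fromℕ m
    fk = fromℕ k

  Seq : Set c
  Seq = ℕ → Carrier

  deriv : Seq → Seq
  deriv f k = f (suc k)

  xMul : Seq → Seq
  xMul f zero    = 0#
  xMul f (suc m) = fromℕ (suc m) * f m

  -- The product of exponential generating functions, by the Leibniz rule.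
  infixl 7 _⊛_
  _⊛_ : Seq → Seq → Seq
  (α ⊛ β) zero    = α 0 * β 0
  (α ⊛ β) (suc m) = (deriv α ⊛ β) m + (α ⊛ deriv β) m

  xMul-cong : ∀ {f g} → (∀ k → f k ≈ g k) → ∀ m → xMul f m ≈ xMul g m
  xMul-cong f≈g zero    = refl
  xMul-cong f≈g (suc m) = *-congˡ (f≈g m)

  xMul-+ : ∀ f g m → xMul (λ k → f k + g k) m ≈ xMul f m + xMul g m
  xMul-+ f g zero    = sym (+-identityʳ _)
  xMul-+ f g (suc m) = distribˡ _ _ _

  xMul-*ˡ : ∀ x f m → xMul (λ k → x * f k) m ≈ x * xMul f m
  xMul-*ˡ x f zero    = sym (zeroʳ _)
  xMul-*ˡ x f (suc m) = solve 3 (λ n x y → n :* (x :* y) := x :* (n :* y)) refl _ _ _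

  xMul-neg : ∀ f m → xMul (λ k → - f k) m ≈ - xMul f m
  xMul-neg f zero    = sym -0#≈0#
  xMul-neg f (suc m) = sym (-‿distribʳ-* _ _)

  xMul-deriv : ∀ h m → xMul (deriv h) m ≈ fromℕ m * h m
  xMul-deriv h zero    = sym (zeroˡ _)
  xMul-deriv h (suc m) = refl

  deriv-xMul : ∀ f k → deriv (xMul f) k ≈ f k + xMul (deriv f) k
  deriv-xMul f zero    = solve 1 (λ y → (:1 :+ :0) :* y := y :+ :0) refl _
  deriv-xMul f (suc k) = solve 2 (λ n y → (:1 :+ n) :* y := y :+ n :* y) refl _ _

  ⊛-cong : ∀ m {α α′ β β′} → (∀ k → α k ≈ α′ k) → (∀ k → β k ≈ β′ k) → (α ⊛ β) m ≈ (α′ ⊛ β′) m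
  ⊛-cong zero    α≈α′ β≈β′ = *-cong (α≈α′ 0) (β≈β′ 0)
  ⊛-cong (suc m) α≈α′ β≈β′ =
    +-cong (⊛-cong m (λ k → α≈α′ (suc k)) β≈β′) (⊛-cong m α≈α′ (λ k → β≈β′ (suc k)))

  ⊛-congʳ : ∀ m α {β β′} → (∀ k → β k ≈ β′ k) → (α ⊛ β) m ≈ (α ⊛ β′) m
  ⊛-congʳ m α = ⊛-cong m (λ _ → refl)

  ⊛-comm : ∀ m α β → (α ⊛ β) m ≈ (β ⊛ α) m
  ⊛-comm zero    α β = *-comm _ _
  ⊛-comm (suc m) α β = trans (+-cong (⊛-comm m (deriv α) β) (⊛-comm m α (deriv β))) (+-comm _ _)

  ⊛-+ʳ : ∀ m α β γ → (α ⊛ (λ k → β k + γ k)) m ≈ (α ⊛ β) m + (α ⊛ γ) m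
  ⊛-+ʳ zero    α β γ = distribˡ _ _ _
  ⊛-+ʳ (suc m) α β γ = trans (+-cong (⊛-+ʳ m (deriv α) β γ) (⊛-+ʳ m α (deriv β) (deriv γ)))
    (solve 4 (λ a b c d → (a :+ b) :+ (c :+ d) := (a :+ c) :+ (b :+ d)) refl _ _ _ _)

  ⊛-*ʳ : ∀ m α x β → (α ⊛ (λ k → x * β k)) m ≈ x * (α ⊛ β) m
  ⊛-*ʳ zero    α x β = solve 3 (λ a x b → a :* (x :* b) := x :* (a :* b)) refl _ _ _
  ⊛-*ʳ (suc m) α x β = trans (+-cong (⊛-*ʳ m (deriv α) x β) (⊛-*ʳ m α x (deriv β))) (sym (distribˡ _ _ _))

  ⊛-negʳ : ∀ m α β → (α ⊛ (λ k → - β k)) m ≈ - (α ⊛ β) m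
  ⊛-negʳ zero    α β = sym (-‿distribʳ-* _ _)
  ⊛-negʳ (suc m) α β = trans (+-cong (⊛-negʳ m (deriv α) β) (⊛-negʳ m α (deriv β))) (-‿+-comm _ _)

  ⊛-+ˡ : ∀ m α β γ → ((λ k → β k + γ k) ⊛ α) m ≈ (β ⊛ α) m + (γ ⊛ α) m
  ⊛-+ˡ m α β γ = trans (⊛-comm m _ α) (trans (⊛-+ʳ m α β γ) (+-cong (⊛-comm m α β) (⊛-comm m α γ)))

  ⊛-*ˡ : ∀ m α x β → ((λ k → x * β k) ⊛ α) m ≈ x * (β ⊛ α) m
  ⊛-*ˡ m α x β = trans (⊛-comm m _ α) (trans (⊛-*ʳ m α x β) (*-congˡ (⊛-comm m α β)))

  ⊛-xMulʳ : ∀ m α γ → (α ⊛ xMul γ) m ≈ xMul (α ⊛ γ) m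
  ⊛-xMulʳ zero    α γ = zeroʳ _
  ⊛-xMulʳ (suc m) α γ = begin
    (deriv α ⊛ xMul γ) m + (α ⊛ deriv (xMul γ)) m
      ≈⟨ +-congˡ (trans (⊛-congʳ m α (deriv-xMul γ)) (⊛-+ʳ m α γ (xMul (deriv γ)))) ⟩
    (deriv α ⊛ xMul γ) m + ((α ⊛ γ) m + (α ⊛ xMul (deriv γ)) m)
      ≈⟨ +-cong (⊛-xMulʳ m (deriv α) γ) (+-congˡ (⊛-xMulʳ m α (deriv γ))) ⟩
    xMul (deriv α ⊛ γ) m + ((α ⊛ γ) m + xMul (α ⊛ deriv γ) m)
      ≈⟨ solve 3 (λ a b c → a :+ (b :+ c) := b :+ (a :+ c)) refl _ _ _ ⟩
    (α ⊛ γ) m + (xMul (deriv α ⊛ γ) m + xMul (α ⊛ deriv γ) m)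
      ≈⟨ +-congˡ (trans (sym (xMul-+ (deriv α ⊛ γ) (α ⊛ deriv γ) m)) (xMul-deriv (α ⊛ γ) m)) ⟩
    (α ⊛ γ) m + fromℕ m * (α ⊛ γ) m
      ≈⟨ solve 2 (λ x n → x :+ n :* x := (:1 :+ n) :* x) refl _ _ ⟩
    (1# + fromℕ m) * (α ⊛ γ) m                                          ∎

  ⊛-xMulˡ : ∀ m α γ → (xMul γ ⊛ α) m ≈ xMul (γ ⊛ α) m
  ⊛-xMulˡ m α γ = trans (⊛-comm m _ α) (trans (⊛-xMulʳ m α γ) (xMul-cong (λ k → ⊛-comm k α γ) m))

  ⊛-binomial : ∀ m α β → (α ⊛ β) m ≈ sumTo m (λ k → fromℕ (m C k) * α k * β (m N.∸ k))
  ⊛-binomial zero    α β = solve 2 (λ a b → a :* b := (:1 :+ :0) :* a :* b) refl _ _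
  ⊛-binomial (suc m) α β = begin
    (deriv α ⊛ β) m + (α ⊛ deriv β) m          ≈⟨ +-cong (⊛-binomial m (deriv α) β) (⊛-binomial m α (deriv β)) ⟩
    sumTo m f + sumTo m g                      ≈⟨ +-congˡ g-shift ⟩
    sumTo m f + (g 0 + sumTo m h)              ≈⟨ solve 3 (λ a b c → a :+ (b :+ c) := b :+ (a :+ c)) refl _ _ _ ⟩
    g 0 + (sumTo m f + sumTo m h)              ≈⟨ +-congˡ (sym (trans (sumTo-cong m pascal) (sumTo-+ m f h))) ⟩
    g 0 + sumTo m (λ k → fromℕ (suc m C suc k) * α (suc k) * β (m N.∸ k)) ≈⟨ sym (sumTo-suc m _) ⟩
    sumTo (suc m) (λ k → fromℕ (suc m C k) * α k * β (suc m N.∸ k)) ∎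
    where
    f g h : ℕ → Carrier
    f k = fromℕ (m C k) * α (suc k) * β (m N.∸ k)
    g k = fromℕ (m C k) * α k * β (suc (m N.∸ k))
    h k = fromℕ (m C suc k) * α (suc k) * β (m N.∸ k)
    pascal : ∀ k → fromℕ (suc m C suc k) * α (suc k) * β (m N.∸ k) ≈ f k + h k
    pascal k = trans (*-congʳ (trans (*-congʳ (fromℕ-pascal m k)) (distribʳ _ _ _))) (distribʳ _ _ _)
    C≡0⇒≈0 : ∀ n k → n C k ≡ 0 → ∀ x y → fromℕ (n C k) * x * y ≈ 0#
    C≡0⇒≈0 n k C≡0 x y = trans (*-congʳ (trans (*-congʳ (reflexive (P.cong fromℕ C≡0))) (zeroˡ _))) (zeroˡ _)
    g-suc : ∀ k → k N.≤ m → g (suc k) ≈ h k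
    g-suc k k≤m with NP.m≤n⇒m<n∨m≡n k≤m
    ... | inj₁ k<m    = reflexive (P.cong (λ t → fromℕ (m C suc k) * α (suc k) * β t) (P.sym (NP.+-∸-assoc 1 k<m)))
    ... | inj₂ P.refl = trans (C≡0⇒≈0 k (suc k) kC[1+k]≡0 _ _) (sym (C≡0⇒≈0 k (suc k) kC[1+k]≡0 _ _))
      where kC[1+k]≡0 = k>n⇒nCk≡0 (NP.n<1+n k)
    g-shift : sumTo m g ≈ g 0 + sumTo m h
    g-shift = begin
      sumTo m g                            ≈⟨ sym (sumTo-last≈0 m g (C≡0⇒≈0 m (suc m) (k>n⇒nCk≡0 (NP.n<1+n m)) _ _)) ⟩
      sumTo (suc m) g                      ≈⟨ sumTo-suc m g ⟩
      g 0 + sumTo m (λ k → g (suc k))      ≈⟨ +-congˡ (sumTo-cong≤ m g-suc) ⟩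
      g 0 + sumTo m h                      ∎

  altRising : Carrier → Seq
  altRising a zero    = 1#
  altRising a (suc k) = - (altRising a k * (a + fromℕ k))

  altRising-cong : ∀ {a a′} → a ≈ a′ → ∀ k → altRising a k ≈ altRising a′ k
  altRising-cong a≈a′ zero    = refl
  altRising-cong a≈a′ (suc k) = -‿cong (*-cong (altRising-cong a≈a′ k) (+-congʳ a≈a′))

  altRising≈pow*rising : ∀ a k → altRising a k ≈ pow (- 1#) k * rising a k
  altRising≈pow*rising a zero    = sym (*-identityˡ _)
  altRising≈pow*rising a (suc k) = trans (-‿cong (*-congʳ (altRising≈pow*rising a k)))
    (solve 3 (λ s R x → :- ((s :* R) :* x) := (s :* :- :1) :* (R :* x)) refl _ _ _)

  altRising-suc : ∀ a k → altRising a (suc k) ≈ - a * altRising (a + 1#) k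
  altRising-suc a zero    = solve 1 (λ a → :- (:1 :* (a :+ :0)) := :- a :* :1) refl a
  altRising-suc a (suc k) = begin
    - (altRising a (suc k) * (a + fromℕ (suc k)))                  ≈⟨ -‿cong (*-congʳ (altRising-suc a k)) ⟩
    - (- a * altRising (a + 1#) k * (a + (1# + fromℕ k)))
      ≈⟨ solve 3 (λ a A n → :- (:- a :* A :* (a :+ (:1 :+ n))) := :- a :* (:- (A :* ((a :+ :1) :+ n)))) refl a _ (fromℕ k) ⟩
    - a * - (altRising (a + 1#) k * ((a + 1#) + fromℕ k))          ∎

  -- In the language of generating functions, the next two lemmas say
  -- (1-x)^{-y} = (1-x)(1-x)^{-(y+1)} and (1+x)^{-a} = (1+x)(1+x)^{-(a+1)}.
  rising-1-x : ∀ y k → rising y k ≈ rising (y + 1#) k + - xMul (rising (y + 1#)) k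
  rising-1-x y zero    = solve 0 (:1 := :1 :+ :- :0) refl
  rising-1-x y (suc k) = begin
    rising y (suc k)                                           ≈⟨ rising-suc y k ⟩
    y * rising (y + 1#) k
      ≈⟨ solve 3 (λ y R n → y :* R := R :* ((y :+ :1) :+ n) :+ :- ((:1 :+ n) :* R)) refl y _ (fromℕ k) ⟩
    rising (y + 1#) k * ((y + 1#) + fromℕ k) + - ((1# + fromℕ k) * rising (y + 1#) k) ∎

  altRising-1+x : ∀ a k → altRising a k ≈ altRising (a + 1#) k + xMul (altRising (a + 1#)) k
  altRising-1+x a zero    = sym (+-identityʳ _)
  altRising-1+x a (suc k) = begin
    altRising a (suc k)                                        ≈⟨ altRising-suc a k ⟩
    - a * altRising (a + 1#) k
      ≈⟨ solve 3 (λ a A n → :- a :* A := :- (A :* ((a :+ :1) :+ n)) :+ ((:1 :+ n) :* A)) refl a _ (fromℕ k) ⟩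
    - (altRising (a + 1#) k * ((a + 1#) + fromℕ k)) + ((1# + fromℕ k) * altRising (a + 1#) k) ∎

  E : Carrier → Carrier → Seq
  E a y = altRising a ⊛ rising y

  E-cong : ∀ {a a′ y y′} → a ≈ a′ → y ≈ y′ → ∀ m → E a y m ≈ E a′ y′ m
  E-cong a≈a′ y≈y′ m = ⊛-cong m (altRising-cong a≈a′) (rising-cong y≈y′)

  E-suc : ∀ a y m → E a y (suc m) ≈ - a * E (a + 1#) y m + y * E a (y + 1#) m
  E-suc a y m = +-cong
    (trans (⊛-cong m (altRising-suc a) (λ _ → refl)) (⊛-*ˡ m (rising y) (- a) (altRising (a + 1#))))
    (trans (⊛-congʳ m (altRising a) (rising-suc y)) (⊛-*ʳ m (altRising a) y (rising (y + 1#))))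

  E-1-x : ∀ a y m → E a y m ≈ E a (y + 1#) m + - xMul (E a (y + 1#)) m
  E-1-x a y m = begin
    E a y m                                                       ≈⟨ ⊛-congʳ m _ (rising-1-x y) ⟩
    (altRising a ⊛ (λ k → rising (y + 1#) k + - xMul (rising (y + 1#)) k)) m ≈⟨ ⊛-+ʳ m _ _ _ ⟩
    E a (y + 1#) m + (altRising a ⊛ (λ k → - xMul (rising (y + 1#)) k)) m    ≈⟨ +-congˡ (⊛-negʳ m _ _) ⟩
    E a (y + 1#) m + - (altRising a ⊛ xMul (rising (y + 1#))) m             ≈⟨ +-congˡ (-‿cong (⊛-xMulʳ m _ _)) ⟩
    E a (y + 1#) m + - xMul (E a (y + 1#)) m                      ∎

  E-1+x : ∀ a y m → E a y m ≈ E (a + 1#) y m + xMul (E (a + 1#) y) m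
  E-1+x a y m = begin
    E a y m                                                            ≈⟨ ⊛-cong m (altRising-1+x a) (λ _ → refl) ⟩
    ((λ k → altRising (a + 1#) k + xMul (altRising (a + 1#)) k) ⊛ rising y) m ≈⟨ ⊛-+ˡ m _ _ _ ⟩
    E (a + 1#) y m + (xMul (altRising (a + 1#)) ⊛ rising y) m          ≈⟨ +-congˡ (⊛-xMulˡ m _ _) ⟩
    E (a + 1#) y m + xMul (E (a + 1#) y) m                             ∎

  E-diag-suc-suc : ∀ a m → E a a (suc (suc m)) ≈ (1# + 1#) * (fromℕ (suc m) * (a * E (a + 1#) (a + 1#) m))
  E-diag-suc-suc a m = begin
    E a a (suc (suc m))                                      ≈⟨ E-suc a a (suc m) ⟩
    - a * E (a + 1#) a (suc m) + a * E a (a + 1#) (suc m)    ≈⟨ +-cong (*-congˡ (E-1-x (a + 1#) a (suc m))) (*-congˡ (E-1+x a (a + 1#) (suc m))) ⟩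
    - a * (X + - (n * D)) + a * (X + n * D)
      ≈⟨ solve 4 (λ a X n D → :- a :* (X :+ :- (n :* D)) :+ a :* (X :+ n :* D) := :2 :* (n :* (a :* D))) refl a X n D ⟩
    (1# + 1#) * (n * (a * D))                                ∎
    where
    X = E (a + 1#) (a + 1#) (suc m)
    n = fromℕ (suc m)
    D = E (a + 1#) (a + 1#) m

  -- (2n)!/n!
  evenCoeff : ℕ → Carrier
  evenCoeff zero    = 1#
  evenCoeff (suc n) = (1# + 1#) * fromℕ (suc (double n)) * evenCoeff n

  E-diag-odd : ∀ n a → E a a (suc (double n)) ≈ 0#
  E-diag-odd zero    a = trans (E-suc a a 0) (solve 1 (λ a → :- a :* (:1 :* :1) :+ a :* (:1 :* :1) := :0) refl a)
  E-diag-odd (suc n) a = trans (E-diag-suc-suc a (suc (double n)))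
    (trans (*-congˡ (*-congˡ (*-congˡ (E-diag-odd n (a + 1#)))))
           (solve 2 (λ n a → :2 :* (n :* (a :* :0)) := :0) refl _ _))

  E-diag-even : ∀ n a → E a a (double n) ≈ evenCoeff n * rising a n
  E-diag-even zero    a = solve 0 (:1 :* :1 := :1 :* :1) refl
  E-diag-even (suc n) a = begin
    E a a (suc (suc (double n)))                                         ≈⟨ E-diag-suc-suc a (double n) ⟩
    (1# + 1#) * (fromℕ (suc (double n)) * (a * E (a + 1#) (a + 1#) (double n))) ≈⟨ *-congˡ (*-congˡ (*-congˡ (E-diag-even n (a + 1#)))) ⟩
    (1# + 1#) * (fromℕ (suc (double n)) * (a * (evenCoeff n * rising (a + 1#) n)))
      ≈⟨ solve 4 (λ m a c r → :2 :* (m :* (a :* (c :* r))) := :2 :* m :* c :* (a :* r)) refl _ _ _ _ ⟩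
    (1# + 1#) * fromℕ (suc (double n)) * evenCoeff n * (a * rising (a + 1#) n) ≈⟨ *-congˡ (sym (rising-suc a n)) ⟩
    evenCoeff (suc n) * rising a (suc n)                                 ∎

  xMul² : Seq → Seq
  xMul² f = xMul (xMul f)

  xMul²-cong : ∀ {f g} → (∀ k → f k ≈ g k) → ∀ m → xMul² f m ≈ xMul² g m
  xMul²-cong f≈g = xMul-cong (xMul-cong f≈g)

  xMul²-+ : ∀ f g m → xMul² (λ k → f k + g k) m ≈ xMul² f m + xMul² g m
  xMul²-+ f g m = trans (xMul-cong (xMul-+ f g) m) (xMul-+ (xMul f) (xMul g) m)

  infix 4 _≈[1-x]·_ _≈[1-x]²·_
  _≈[1-x]·_ : Seq → Seq → Set ℓ
  h ≈[1-x]· g = ∀ m → h m ≈ g m + - xMul g m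

  _≈[1-x]²·_ : Seq → Seq → Set ℓ
  h ≈[1-x]²· g = ∀ m → h m ≈ g m + - ((1# + 1#) * xMul g m) + xMul² g m

  [1-x]·-twice : ∀ {g h k} → h ≈[1-x]· g → k ≈[1-x]· h → k ≈[1-x]²· g
  [1-x]·-twice {g} {h} {k} h≈ k≈ m = begin
    k m                                                    ≈⟨ k≈ m ⟩
    h m + - xMul h m                                       ≈⟨ +-cong (h≈ m) (-‿cong (xMul-cong h≈ m)) ⟩
    (g m + - xMul g m) + - xMul (λ j → g j + - xMul g j) m ≈⟨ +-congˡ (-‿cong (trans (xMul-+ _ _ m) (+-congˡ (xMul-neg _ m)))) ⟩
    (g m + - xMul g m) + - (xMul g m + - xMul² g m)
      ≈⟨ solve 3 (λ a b c → (a :+ :- b) :+ :- (b :+ :- c) := a :+ :- (:2 :* b) :+ c) refl _ _ _ ⟩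
    g m + - ((1# + 1#) * xMul g m) + xMul² g m             ∎

  [1-x]²·-xMul : ∀ {g h} → h ≈[1-x]²· g → xMul h ≈[1-x]²· xMul g
  [1-x]²·-xMul {g} {h} h≈ m = begin
    xMul h m                                                           ≈⟨ xMul-cong h≈ m ⟩
    xMul (λ k → g k + - ((1# + 1#) * xMul g k) + xMul² g k) m           ≈⟨ xMul-+ _ _ m ⟩
    xMul (λ k → g k + - ((1# + 1#) * xMul g k)) m + xMul (xMul² g) m    ≈⟨ +-congʳ (xMul-+ _ _ m) ⟩
    xMul g m + xMul (λ k → - ((1# + 1#) * xMul g k)) m + xMul (xMul² g) m ≈⟨ +-congʳ (+-congˡ (xMul-neg _ m)) ⟩
    xMul g m + - xMul (λ k → (1# + 1#) * xMul g k) m + xMul (xMul² g) m ≈⟨ +-congʳ (+-congˡ (-‿cong (xMul-*ˡ _ _ m))) ⟩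
    xMul g m + - ((1# + 1#) * xMul² g m) + xMul (xMul² g) m             ∎

  -- (1-x)⁴ = 2(1-x)² + 2x²(1-x)² - 1 + 2x² - x⁴: besides (1-x)² only even
  -- powers of x occur, so the identity descends to even coefficients.
  [1-x]⁴-even : ∀ {g h k} → h ≈[1-x]²· g → k ≈[1-x]²· h → ∀ m →
    k m ≈ (1# + 1#) * h m + (1# + 1#) * xMul² h m + - g m + (1# + 1#) * xMul² g m + - xMul² (xMul² g) m
  [1-x]⁴-even {g} {h} {k} h≈ k≈ m = begin
    k m                                         ≈⟨ k≈ m ⟩
    h m + - ((1# + 1#) * xMul h m) + xMul² h m   ≈⟨ +-cong (+-cong (h≈ m) (-‿cong (*-congˡ (xh≈ m)))) (xxh≈ m) ⟩
    (g₀ + - ((1# + 1#) * g₁) + g₂) + - ((1# + 1#) * (g₁ + - ((1# + 1#) * g₂) + g₃)) + (g₂ + - ((1# + 1#) * g₃) + g₄)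
      ≈⟨ solve 5 (λ g₀ g₁ g₂ g₃ g₄ →
           (g₀ :+ :- (:2 :* g₁) :+ g₂) :+ :- (:2 :* (g₁ :+ :- (:2 :* g₂) :+ g₃)) :+ (g₂ :+ :- (:2 :* g₃) :+ g₄)
           := :2 :* (g₀ :+ :- (:2 :* g₁) :+ g₂) :+ :2 :* (g₂ :+ :- (:2 :* g₃) :+ g₄) :+ :- g₀ :+ :2 :* g₂ :+ :- g₄)
           refl g₀ g₁ g₂ g₃ g₄ ⟩
    (1# + 1#) * (g₀ + - ((1# + 1#) * g₁) + g₂) + (1# + 1#) * (g₂ + - ((1# + 1#) * g₃) + g₄) + - g₀ + (1# + 1#) * g₂ + - g₄
      ≈⟨ +-congʳ (+-congʳ (+-congʳ (+-cong (*-congˡ (sym (h≈ m))) (*-congˡ (sym (xxh≈ m)))))) ⟩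
    (1# + 1#) * h m + (1# + 1#) * xMul² h m + - g m + (1# + 1#) * xMul² g m + - xMul² (xMul² g) m ∎
    where
    g₀ = g m
    g₁ = xMul g m
    g₂ = xMul² g m
    g₃ = xMul (xMul² g) m
    g₄ = xMul² (xMul² g) m
    xh≈ : xMul h ≈[1-x]²· xMul g
    xh≈ = [1-x]²·-xMul h≈
    xxh≈ : xMul² h ≈[1-x]²· xMul² g
    xxh≈ = [1-x]²·-xMul xh≈

  fromℕ-double : ∀ k → fromℕ (double k) ≈ (1# + 1#) * fromℕ k
  fromℕ-double zero    = sym (zeroʳ _)
  fromℕ-double (suc k) = trans (+-congˡ (+-congˡ (fromℕ-double k)))
    (solve 1 (λ n → :1 :+ (:1 :+ :2 :* n) := :2 :* (:1 :+ n)) refl _)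

  xMul²-even : ∀ (G Y : Seq) → (∀ k → G (double k) ≈ evenCoeff k * Y k) →
               ∀ k → xMul² G (double k) ≈ evenCoeff k * xMul Y k
  xMul²-even G Y G≈ zero    = sym (zeroʳ _)
  xMul²-even G Y G≈ (suc k) = begin
    fromℕ (suc (suc (double k))) * (fromℕ (suc (double k)) * G (double k)) ≈⟨ *-cong (fromℕ-double (suc k)) (*-congˡ (G≈ k)) ⟩
    (1# + 1#) * fromℕ (suc k) * (fromℕ (suc (double k)) * (evenCoeff k * Y k))
      ≈⟨ solve 4 (λ n m c y → :2 :* n :* (m :* (c :* y)) := :2 :* m :* c :* (n :* y)) refl _ _ _ _ ⟩
    (1# + 1#) * fromℕ (suc (double k)) * evenCoeff k * (fromℕ (suc k) * Y k) ∎

  evenStep : Seq → Seq → Seq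
  evenStep f g k = (1# + 1#) * f k + (1# + 1#) * xMul f k + - g k + (1# + 1#) * xMul g k + - xMul² g k

  EvenPartRecurrence : (ℕ → Seq) → Set ℓ
  EvenPartRecurrence Y = ∀ r k → Y (suc (suc r)) k ≈ evenStep (Y (suc r)) (Y r) k

  xMul-E-diag-double : ∀ a k → xMul (E a a) (double k) ≈ 0#
  xMul-E-diag-double a zero    = refl
  xMul-E-diag-double a (suc k) = trans (*-congˡ (E-diag-odd k a)) (zeroʳ _)

  module _ (a : Carrier) where

    G : ℕ → Seq
    G j = E a ((a + 1#) + - fromℕ j)

    G-suc : ∀ j → G (suc j) ≈[1-x]· G j
    G-suc j m = trans (E-1-x a _ m) (+-cong (E-cong refl y≈ m) (-‿cong (xMul-cong (E-cong refl y≈) m)))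
      where
      y≈ : ((a + 1#) + - fromℕ (suc j)) + 1# ≈ (a + 1#) + - fromℕ j
      y≈ = solve 2 (λ a n → ((a :+ :1) :+ :- (:1 :+ n)) :+ :1 := (a :+ :1) :+ :- n) refl a (fromℕ j)

    G-double-suc : ∀ r → G (double (suc r)) ≈[1-x]²· G (double r)
    G-double-suc r = [1-x]·-twice (G-suc (double r)) (G-suc (suc (double r)))

    G-0-even : ∀ k → G 0 (double k) ≈ evenCoeff k * rising (a + 1#) k
    G-0-even k = begin
      G 0 (double k)                                           ≈⟨ E-cong refl (trans (+-congˡ -0#≈0#) (+-identityʳ _)) (double k) ⟩
      E a (a + 1#) (double k)                                  ≈⟨ E-1+x a (a + 1#) (double k) ⟩
      E (a + 1#) (a + 1#) (double k) + xMul (E (a + 1#) (a + 1#)) (double k)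
        ≈⟨ +-cong (E-diag-even k (a + 1#)) (xMul-E-diag-double (a + 1#) k) ⟩
      evenCoeff k * rising (a + 1#) k + 0#                     ≈⟨ +-identityʳ _ ⟩
      evenCoeff k * rising (a + 1#) k                          ∎

    G-2-even : ∀ k → G 2 (double k) ≈ evenCoeff k * rising a k
    G-2-even k = begin
      G 2 (double k)                                           ≈⟨ E-1-x a _ (double k) ⟩
      E a y (double k) + - xMul (E a y) (double k)             ≈⟨ +-cong (E-cong refl y≈a (double k)) (-‿cong (xMul-cong (E-cong refl y≈a) (double k))) ⟩
      E a a (double k) + - xMul (E a a) (double k)             ≈⟨ +-cong (E-diag-even k a) (trans (-‿cong (xMul-E-diag-double a k)) -0#≈0#) ⟩
      evenCoeff k * rising a k + 0#                            ≈⟨ +-identityʳ _ ⟩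
      evenCoeff k * rising a k                                 ∎
      where
      y = ((a + 1#) + - fromℕ 2) + 1#
      y≈a : y ≈ a
      y≈a = solve 1 (λ a → ((a :+ :1) :+ :- (:1 :+ (:1 :+ :0))) :+ :1 := a) refl a

    G-double-even : ∀ (Y : ℕ → Seq) → (∀ k → Y 0 k ≈ rising (a + 1#) k) → (∀ k → Y 1 k ≈ rising a k) →
                    EvenPartRecurrence Y → ∀ r k → G (double r) (double k) ≈ evenCoeff k * Y r k
    G-double-even Y Y₀ Y₁ Y-rec r = proj₁ (consecutive r)
      where
      Holds : ℕ → Set ℓ
      Holds r = ∀ k → G (double r) (double k) ≈ evenCoeff k * Y r k

      step : ∀ r → Holds r → Holds (suc r) → Holds (suc (suc r))
      step r hyp₀ hyp₁ k = begin
        G (double (suc (suc r))) (double k)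
          ≈⟨ [1-x]⁴-even (G-double-suc r) (G-double-suc (suc r)) (double k) ⟩
        (1# + 1#) * G₁ (double k) + (1# + 1#) * xMul² G₁ (double k) + - G₀ (double k)
          + (1# + 1#) * xMul² G₀ (double k) + - xMul² (xMul² G₀) (double k)
          ≈⟨ +-cong (+-cong (+-cong (+-cong (*-congˡ (hyp₁ k)) (*-congˡ (xMul²-even _ _ hyp₁ k))) (-‿cong (hyp₀ k)))
                    (*-congˡ (xMul²-even _ _ hyp₀ k))) (-‿cong (xMul²-even _ _ (xMul²-even _ _ hyp₀) k)) ⟩
        (1# + 1#) * (κ * y₁) + (1# + 1#) * (κ * xy₁) + - (κ * y₀) + (1# + 1#) * (κ * xy₀) + - (κ * xxy₀)
          ≈⟨ solve 6 (λ κ y₁ xy₁ y₀ xy₀ xxy₀ →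
               :2 :* (κ :* y₁) :+ :2 :* (κ :* xy₁) :+ :- (κ :* y₀) :+ :2 :* (κ :* xy₀) :+ :- (κ :* xxy₀)
               := κ :* (:2 :* y₁ :+ :2 :* xy₁ :+ :- y₀ :+ :2 :* xy₀ :+ :- xxy₀)) refl κ y₁ xy₁ y₀ xy₀ xxy₀ ⟩
        κ * ((1# + 1#) * y₁ + (1# + 1#) * xy₁ + - y₀ + (1# + 1#) * xy₀ + - xxy₀)
          ≈⟨ *-congˡ (sym (Y-rec r k)) ⟩
        evenCoeff k * Y (suc (suc r)) k ∎
        where
        G₀ = G (double r)
        G₁ = G (double (suc r))
        κ = evenCoeff k
        y₁ = Y (suc r) k
        xy₁ = xMul (Y (suc r)) k
        y₀ = Y r k
        xy₀ = xMul (Y r) k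
        xxy₀ = xMul² (Y r) k

      consecutive : ∀ r → Holds r × Holds (suc r)
      consecutive zero    = (λ k → trans (G-0-even k) (*-congˡ (sym (Y₀ k))))
                          , (λ k → trans (G-2-even k) (*-congˡ (sym (Y₁ k))))
      consecutive (suc r) = proj₂ (consecutive r) , step r (proj₁ (consecutive r)) (proj₂ (consecutive r))

  evenStep-cong : ∀ {f f′ g g′} → (∀ k → f k ≈ f′ k) → (∀ k → g k ≈ g′ k) → ∀ k → evenStep f g k ≈ evenStep f′ g′ k
  evenStep-cong f≈ g≈ k = +-cong (+-cong (+-cong (+-cong (*-congˡ (f≈ k)) (*-congˡ (xMul-cong f≈ k)))
    (-‿cong (g≈ k))) (*-congˡ (xMul-cong g≈ k))) (-‿cong (xMul²-cong g≈ k))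

  evenStep-+ : ∀ f f′ g g′ k → evenStep (λ n → f n + f′ n) (λ n → g n + g′ n) k ≈ evenStep f g k + evenStep f′ g′ k
  evenStep-+ f f′ g g′ k = trans
    (+-cong (+-cong (+-congʳ (+-congˡ (*-congˡ (xMul-+ f f′ k)))) (*-congˡ (xMul-+ g g′ k))) (-‿cong (xMul²-+ g g′ k)))
    (solve 10 (λ a a′ b b′ c c′ d d′ e e′ →
       :2 :* (a :+ a′) :+ :2 :* (b :+ b′) :+ :- (c :+ c′) :+ :2 :* (d :+ d′) :+ :- (e :+ e′)
       := (:2 :* a :+ :2 :* b :+ :- c :+ :2 :* d :+ :- e) :+ (:2 :* a′ :+ :2 :* b′ :+ :- c′ :+ :2 :* d′ :+ :- e′))
       refl (f k) (f′ k) (xMul f k) (xMul f′ k) (g k) (g′ k) (xMul g k) (xMul g′ k) (xMul² g k) (xMul² g′ k))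

  evenStep-sumTo : ∀ N (F H : ℕ → Seq) k →
    evenStep (λ n → sumTo N (λ i → F i n)) (λ n → sumTo N (λ i → H i n)) k ≈ sumTo N (λ i → evenStep (F i) (H i) k)
  evenStep-sumTo zero    F H k = refl
  evenStep-sumTo (suc N) F H k = trans (evenStep-+ _ (F (suc N)) _ (H (suc N)) k) (+-congʳ (evenStep-sumTo N F H k))

  evenStep-scale : ∀ x f y g k → evenStep (λ n → x * f n) (λ n → y * g n) k
    ≈ (1# + 1#) * (x * f k) + (1# + 1#) * (x * xMul f k) + - (y * g k) + (1# + 1#) * (y * xMul g k) + - (y * xMul² g k)
  evenStep-scale x f y g k = +-cong (+-cong (+-congʳ (+-congˡ (*-congˡ (xMul-*ˡ x f k)))) (*-congˡ (xMul-*ˡ y g k)))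
    (-‿cong (trans (xMul-cong (xMul-*ˡ y g) k) (xMul-*ˡ y (xMul g) k)))

  xPowRising : ℕ → Carrier → Seq
  xPowRising zero    w = rising w
  xPowRising (suc i) w = xMul (xPowRising i w)

  xPowRising-cong : ∀ i {w w′} → w ≈ w′ → ∀ n → xPowRising i w n ≈ xPowRising i w′ n
  xPowRising-cong zero    w≈w′ = rising-cong w≈w′
  xPowRising-cong (suc i) w≈w′ = xMul-cong (xPowRising-cong i w≈w′)

  xPowRising-1-x : ∀ i w n → xPowRising i w n ≈ xPowRising i (w + - 1#) n + xMul (xPowRising i w) n
  xPowRising-1-x zero w n = begin
    rising w n                                                 ≈⟨ solve 2 (λ a b → a := (a :+ :- b) :+ b) refl _ _ ⟩
    (rising w n + - xMul (rising w) n) + xMul (rising w) n     ≈⟨ +-congʳ (sym lower) ⟩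
    rising (w + - 1#) n + xMul (rising w) n                    ∎
    where
    w-1+1 : (w + - 1#) + 1# ≈ w
    w-1+1 = solve 1 (λ w → (w :+ :- :1) :+ :1 := w) refl w
    lower : rising (w + - 1#) n ≈ rising w n + - xMul (rising w) n
    lower = trans (rising-1-x (w + - 1#) n) (+-cong (rising-cong w-1+1 n) (-‿cong (xMul-cong (rising-cong w-1+1) n)))
  xPowRising-1-x (suc i) w n = trans (xMul-cong (xPowRising-1-x i w) n) (xMul-+ _ _ n)

  fromℕ-C-second-difference : ∀ N k → fromℕ (suc (suc N) C suc (suc k))
    ≈ (1# + 1#) * fromℕ (suc N C suc (suc k)) + - fromℕ (N C suc (suc k)) + fromℕ (N C k)
  fromℕ-C-second-difference N k = begin
    A                         ≈⟨ solve 2 (λ A B → A := (A :+ B) :+ :- B) refl A B ⟩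
    (A + B) + - B             ≈⟨ +-congʳ (sym (fromℕ-+ (suc (suc N) C suc (suc k)) (N C suc (suc k)))) ⟩
    fromℕ (suc (suc N) C suc (suc k) N.+ N C suc (suc k)) + - B
      ≡⟨ P.cong (λ t → fromℕ t + - B) (C-second-difference N k) ⟩
    fromℕ (suc N C suc (suc k) N.+ suc N C suc (suc k) N.+ N C k) + - B
      ≈⟨ +-congʳ (trans (fromℕ-+ (suc N C suc (suc k) N.+ suc N C suc (suc k)) (N C k))
                        (+-congʳ (fromℕ-+ (suc N C suc (suc k)) (suc N C suc (suc k))))) ⟩
    (A′ + A′ + D) + - B       ≈⟨ solve 3 (λ A′ B D → (A′ :+ A′ :+ D) :+ :- B := :2 :* A′ :+ :- B :+ D) refl A′ B D ⟩
    (1# + 1#) * A′ + - B + D  ∎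
    where
    A  = fromℕ (suc (suc N) C suc (suc k))
    A′ = fromℕ (suc N C suc (suc k))
    B  = fromℕ (N C suc (suc k))
    D  = fromℕ (N C k)

  coeff : ℕ → ℕ → Carrier
  coeff r i = pow two (2 N.* i) * fromℕ ((r N.+ i N.∸ 1) C (2 N.* i))

  prev : Seq → Seq
  prev f zero    = 0#
  prev f (suc i) = f i

  coeff-suc : ∀ r i → coeff r (suc i) ≡ pow two (2 N.* i) * two * two * fromℕ ((r N.+ i) C suc (suc (2 N.* i)))
  coeff-suc r i = P.cong₂ (λ k M → pow two k * fromℕ (M C k)) (2*suc i) (P.cong (N._∸ 1) (NP.+-suc r i))

  coeff-rec : ∀ r i → coeff (suc (suc r)) i
    ≈ (1# + 1#) * coeff (suc r) i + - coeff r i + (1# + 1#) * (1# + 1#) * prev (coeff (suc r)) i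
  coeff-rec r zero    = solve 0 (:1 :* (:1 :+ :0) := :2 :* (:1 :* (:1 :+ :0)) :+ :- (:1 :* (:1 :+ :0)) :+ :2 :* :2 :* :0) refl
  coeff-rec r (suc i) = begin
    coeff (suc (suc r)) (suc i)                ≡⟨ coeff-suc (suc (suc r)) i ⟩
    p * two * two * fromℕ (suc (suc N) C suc (suc k)) ≈⟨ *-cong (*-cong (*-congˡ two≈1+1) two≈1+1) (fromℕ-C-second-difference N k) ⟩
    p * (1# + 1#) * (1# + 1#) * ((1# + 1#) * A + - B + D)
      ≈⟨ solve 4 (λ p A B D → p :* :2 :* :2 :* (:2 :* A :+ :- B :+ D) := :2 :* (p :* :2 :* :2 :* A) :+ :- (p :* :2 :* :2 :* B) :+ :2 :* :2 :* (p :* D))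
           refl p A B D ⟩
    (1# + 1#) * (p * (1# + 1#) * (1# + 1#) * A) + - (p * (1# + 1#) * (1# + 1#) * B) + (1# + 1#) * (1# + 1#) * (p * D)
      ≈⟨ sym (+-congʳ (+-cong (*-congˡ (*-congʳ p22)) (-‿cong (*-congʳ p22)))) ⟩
    (1# + 1#) * (p * two * two * A) + - (p * two * two * B) + (1# + 1#) * (1# + 1#) * (p * D)
      ≡⟨ P.sym (P.cong₂ (λ x y → (1# + 1#) * x + - y + (1# + 1#) * (1# + 1#) * (p * D)) (coeff-suc (suc r) i) (coeff-suc r i)) ⟩
    (1# + 1#) * coeff (suc r) (suc i) + - coeff r (suc i) + (1# + 1#) * (1# + 1#) * prev (coeff (suc r)) (suc i) ∎
    where
    N = r N.+ i
    k = 2 N.* i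
    p = pow two k
    A = fromℕ (suc N C suc (suc k))
    B = fromℕ (N C suc (suc k))
    D = fromℕ (N C k)
    p22 : p * two * two ≈ p * (1# + 1#) * (1# + 1#)
    p22 = *-cong (*-congˡ two≈1+1) two≈1+1

  coeff-vanish : ∀ r i → r N.≤ suc i → coeff r (suc i) ≈ 0#
  coeff-vanish r i r≤1+i = trans (*-congˡ (reflexive (P.cong fromℕ (k>n⇒nCk≡0 r+i<2+2i)))) (zeroʳ _)
    where
    r+i<2+2i : r N.+ suc i N.∸ 1 N.< 2 N.* suc i
    r+i<2+2i = P.subst₂ N._<_ (P.cong (N._∸ 1) (P.sym (NP.+-suc r i)))
                 (P.trans (P.cong (λ t → suc (suc (i N.+ t))) (P.sym (NP.+-identityʳ i))) (P.sym (2*suc i)))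
                 (N.s≤s (NP.+-monoˡ-≤ i r≤1+i))

  module _ (a : Carrier) where

    basis : ℕ → ℕ → Seq
    basis r i = xPowRising i (((a + 1#) + - fromℕ r) + fromℕ i)

    xMul-basis : ∀ r i n → xMul (basis r i) n ≈ basis (suc r) (suc i) n
    xMul-basis r i = xPowRising-cong (suc i)
      (solve 3 (λ a r i → ((a :+ :1) :+ :- r) :+ i := ((a :+ :1) :+ :- (:1 :+ r)) :+ (:1 :+ i)) refl a (fromℕ r) (fromℕ i))

    basis-split : ∀ r i n → basis r i n ≈ basis (suc r) i n + basis (suc r) (suc i) n
    basis-split r i n = trans (xPowRising-1-x i _ n) (+-cong (xPowRising-cong i w-1 n) (xMul-basis r i n))
      where
      w-1 : (((a + 1#) + - fromℕ r) + fromℕ i) + - 1# ≈ ((a + 1#) + - fromℕ (suc r)) + fromℕ i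
      w-1 = solve 3 (λ a r i → (((a :+ :1) :+ :- r) :+ i) :+ :- :1 := ((a :+ :1) :+ :- (:1 :+ r)) :+ i) refl a (fromℕ r) (fromℕ i)

    targetSum : ℕ → Seq
    targetSum r n = sumTo r (λ i → coeff r i * basis r i n)

    targetSum-0 : ∀ k → targetSum 0 k ≈ rising (a + 1#) k
    targetSum-0 k = trans (*-cong (solve 0 (:1 :* (:1 :+ :0) := :1) refl)
                                  (rising-cong (solve 1 (λ a → ((a :+ :1) :+ :- :0) :+ :0 := a :+ :1) refl a) k))
                          (*-identityˡ _)

    targetSum-1 : ∀ k → targetSum 1 k ≈ rising a k
    targetSum-1 k = trans (+-cong (*-cong (solve 0 (:1 :* (:1 :+ :0) := :1) refl)
                                          (rising-cong (solve 1 (λ a → ((a :+ :1) :+ :- (:1 :+ :0)) :+ :0 := a) refl a) k))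
                                  (trans (*-congʳ (coeff-vanish 1 0 (N.s≤s N.z≤n))) (zeroˡ _)))
                          (trans (+-identityʳ _) (*-identityˡ _))

    targetSum-extend : ∀ r n → targetSum r n ≈ sumTo (suc r) (λ i → coeff r i * basis r i n)
    targetSum-extend r n = sym (sumTo-last≈0 r _ (trans (*-congʳ (coeff-vanish r r (NP.n≤1+n r))) (zeroˡ _)))

    evenStep-summand : ∀ r i k →
      evenStep (λ n → coeff (suc r) i * basis (suc r) i n) (λ n → coeff r i * basis r i n) k
      ≈ ((1# + 1#) * coeff (suc r) i + - coeff r i) * basis (suc (suc r)) i k
        + (1# + 1#) * (1# + 1#) * coeff (suc r) i * basis (suc (suc r)) (suc i) k
    evenStep-summand r i k = begin
      evenStep (λ n → e₁ * basis (suc r) i n) (λ n → e₀ * basis r i n) k  ≈⟨ evenStep-scale e₁ _ e₀ _ k ⟩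
      (1# + 1#) * (e₁ * basis (suc r) i k) + (1# + 1#) * (e₁ * xMul (basis (suc r) i) k) + - (e₀ * basis r i k)
        + (1# + 1#) * (e₀ * xMul (basis r i) k) + - (e₀ * xMul² (basis r i) k)
        ≈⟨ +-cong (+-cong (+-cong (+-cong (*-congˡ (*-congˡ (basis-split (suc r) i k)))
                                          (*-congˡ (*-congˡ (xMul-basis (suc r) i k))))
                                  (-‿cong (*-congˡ (trans (basis-split r i k) (+-cong (basis-split (suc r) i k) (basis-split (suc r) (suc i) k))))))
                          (*-congˡ (*-congˡ (trans (xMul-basis r i k) (basis-split (suc r) (suc i) k)))))
                  (-‿cong (*-congˡ (trans (xMul-cong (xMul-basis r i) k) (xMul-basis (suc r) (suc i) k)))) ⟩
      (1# + 1#) * (e₁ * (P₀ + P₁)) + (1# + 1#) * (e₁ * P₁) + - (e₀ * ((P₀ + P₁) + (P₁ + P₂)))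
        + (1# + 1#) * (e₀ * (P₁ + P₂)) + - (e₀ * P₂)
        ≈⟨ solve 5 (λ e₁ e₀ P₀ P₁ P₂ →
             :2 :* (e₁ :* (P₀ :+ P₁)) :+ :2 :* (e₁ :* P₁) :+ :- (e₀ :* ((P₀ :+ P₁) :+ (P₁ :+ P₂)))
               :+ :2 :* (e₀ :* (P₁ :+ P₂)) :+ :- (e₀ :* P₂)
             := (:2 :* e₁ :+ :- e₀) :* P₀ :+ :2 :* :2 :* e₁ :* P₁) refl e₁ e₀ P₀ P₁ P₂ ⟩
      ((1# + 1#) * e₁ + - e₀) * P₀ + (1# + 1#) * (1# + 1#) * e₁ * P₁   ∎
      where
      e₁ = coeff (suc r) i
      e₀ = coeff r i
      P₀ = basis (suc (suc r)) i k
      P₁ = basis (suc (suc r)) (suc i) k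
      P₂ = basis (suc (suc r)) (suc (suc i)) k

    targetSum-rec : EvenPartRecurrence targetSum
    targetSum-rec r k = begin
      sumTo (suc (suc r)) (λ i → coeff (suc (suc r)) i * P i)
        ≈⟨ sumTo-cong (suc (suc r)) (λ i → trans (*-congʳ (coeff-rec r i)) (distribʳ _ _ _)) ⟩
      sumTo (suc (suc r)) (λ i → f i + g i)                   ≈⟨ sumTo-+ (suc (suc r)) f g ⟩
      sumTo (suc (suc r)) f + sumTo (suc (suc r)) g           ≈⟨ +-cong (sumTo-last≈0 (suc r) f f-last) (sumTo-suc (suc r) g) ⟩
      sumTo (suc r) f + (g 0 + sumTo (suc r) (λ i → g (suc i))) ≈⟨ +-congˡ (trans (+-congʳ g-0) (+-identityˡ _)) ⟩
      sumTo (suc r) f + sumTo (suc r) (λ i → g (suc i))       ≈⟨ sym (sumTo-+ (suc r) f (λ i → g (suc i))) ⟩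
      sumTo (suc r) (λ i → f i + g (suc i))                   ≈⟨ sumTo-cong (suc r) (λ i → sym (evenStep-summand r i k)) ⟩
      sumTo (suc r) (λ i → evenStep (λ n → coeff (suc r) i * basis (suc r) i n) (λ n → coeff r i * basis r i n) k)
        ≈⟨ sym (evenStep-sumTo (suc r) _ _ k) ⟩
      evenStep (targetSum (suc r)) (λ n → sumTo (suc r) (λ i → coeff r i * basis r i n)) k
        ≈⟨ sym (evenStep-cong (λ _ → refl) (targetSum-extend r) k) ⟩
      evenStep (targetSum (suc r)) (targetSum r) k            ∎
      where
      P : ℕ → Carrier
      P i = basis (suc (suc r)) i k
      f g : ℕ → Carrier
      f i = ((1# + 1#) * coeff (suc r) i + - coeff r i) * P i
      g i = (1# + 1#) * (1# + 1#) * prev (coeff (suc r)) i * P i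
      f-last : f (suc (suc r)) ≈ 0#
      f-last = trans (*-congʳ (+-cong (*-congˡ (coeff-vanish (suc r) (suc r) (NP.n≤1+n _)))
                                      (-‿cong (coeff-vanish r (suc r) (NP.m≤n⇒m≤1+n (NP.n≤1+n r))))))
                     (solve 1 (λ p → (:2 :* :0 :+ :- :0) :* p := :0) refl _)
      g-0 : g 0 ≈ 0#
      g-0 = solve 1 (λ p → :2 :* :2 :* :0 :* p := :0) refl _

  rising-2*suc : ∀ y n → rising y (2 N.* suc n) ≈ rising y (2 N.* n) * (y + fromℕ (2 N.* n)) * (y + fromℕ (suc (2 N.* n)))
  rising-2*suc y n = reflexive (P.cong (rising y) (2*suc n))

  pow-two-2*suc : ∀ n → pow two (2 N.* suc n) ≈ pow two (2 N.* n) * two * two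
  pow-two-2*suc n = reflexive (P.cong (pow two) (2*suc n))

  rising-duplication : ∀ y u v → u * two ≈ y + 1# → v * two ≈ y →
                       ∀ n → pow two (2 N.* n) * (rising u n * rising v n) ≈ rising y (2 N.* n)
  rising-duplication y u v 2u≈y+1 2v≈y zero    = solve 0 (:1 :* (:1 :* :1) := :1) refl
  rising-duplication y u v 2u≈y+1 2v≈y (suc n) = begin
    pow two (2 N.* suc n) * (rising u n * (u + fn) * (rising v n * (v + fn)))
      ≈⟨ *-congʳ (pow-two-2*suc n) ⟩
    pow two (2 N.* n) * two * two * (rising u n * (u + fn) * (rising v n * (v + fn)))
      ≈⟨ solve 7 (λ p t U u V v n → p :* t :* t :* (U :* (u :+ n) :* (V :* (v :+ n))) := (p :* (U :* V)) :* (((u :+ n) :* t) :* ((v :+ n) :* t)))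
           refl _ two _ u _ v fn ⟩
    (pow two (2 N.* n) * (rising u n * rising v n)) * (((u + fn) * two) * ((v + fn) * two))
      ≈⟨ *-cong (rising-duplication y u v 2u≈y+1 2v≈y n) (*-cong 2[u+n] 2[v+n]) ⟩
    rising y (2 N.* n) * ((y + fromℕ (suc (2 N.* n))) * (y + fromℕ (2 N.* n)))
      ≈⟨ solve 3 (λ R a c → R :* (a :* c) := R :* c :* a) refl _ _ _ ⟩
    rising y (2 N.* n) * (y + fromℕ (2 N.* n)) * (y + fromℕ (suc (2 N.* n))) ≈⟨ sym (rising-2*suc y n) ⟩
    rising y (2 N.* suc n) ∎
    where
    fn = fromℕ n
    2[u+n] : (u + fn) * two ≈ y + fromℕ (suc (2 N.* n))
    2[u+n] = begin
      (u + fn) * two                  ≈⟨ distribʳ _ _ _ ⟩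
      u * two + fn * two              ≈⟨ +-cong 2u≈y+1 (*-congˡ two≈1+1) ⟩
      (y + 1#) + fn * (1# + 1#)       ≈⟨ solve 2 (λ y n → (y :+ :1) :+ n :* :2 := y :+ (:1 :+ :2 :* n)) refl y fn ⟩
      y + (1# + (1# + 1#) * fn)       ≈⟨ +-congˡ (+-congˡ (sym (fromℕ-2* n))) ⟩
      y + fromℕ (suc (2 N.* n))       ∎
    2[v+n] : (v + fn) * two ≈ y + fromℕ (2 N.* n)
    2[v+n] = begin
      (v + fn) * two                  ≈⟨ distribʳ _ _ _ ⟩
      v * two + fn * two              ≈⟨ +-cong 2v≈y (*-congˡ two≈1+1) ⟩
      y + fn * (1# + 1#)              ≈⟨ +-congˡ (trans (*-comm _ _) (sym (fromℕ-2* n))) ⟩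
      y + fromℕ (2 N.* n)             ∎

  rising-half*4^n : ∀ n → rising half n * pow two (2 N.* n) ≈ evenCoeff n
  rising-half*4^n zero    = *-identityˡ _
  rising-half*4^n (suc n) = begin
    rising half n * (half + fn) * pow two (2 N.* suc n)            ≈⟨ *-congˡ (pow-two-2*suc n) ⟩
    rising half n * (half + fn) * (pow two (2 N.* n) * two * two)
      ≈⟨ solve 5 (λ R h n p t → R :* (h :+ n) :* (p :* t :* t) := (R :* p) :* ((h :* t) :* t :+ n :* t :* t)) refl _ half fn _ two ⟩
    (rising half n * pow two (2 N.* n)) * ((half * two) * two + fn * two * two)
      ≈⟨ *-cong (rising-half*4^n n) (+-cong (*-cong half*two≈1 two≈1+1) (*-cong (*-congˡ two≈1+1) two≈1+1)) ⟩
    evenCoeff n * (1# * (1# + 1#) + fn * (1# + 1#) * (1# + 1#))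
      ≈⟨ solve 2 (λ c n → c :* (:1 :* :2 :+ n :* :2 :* :2) := :2 :* (:1 :+ :2 :* n) :* c) refl _ _ ⟩
    (1# + 1#) * (1# + (1# + 1#) * fn) * evenCoeff n                ≈⟨ *-congʳ (*-congˡ (+-congˡ (sym (fromℕ-double n)))) ⟩
    evenCoeff (suc n)                                              ∎
    where fn = fromℕ n

  rising-split-reflect : ∀ y m k → k N.≤ m →
    rising y m ≈ rising y (m N.∸ k) * (pow (- 1#) k * rising (- (y + fromℕ m) + 1#) k)
  rising-split-reflect y m k k≤m = begin
    rising y m                                                 ≡⟨ P.cong (rising y) (P.sym (NP.m∸n+n≡m k≤m)) ⟩
    rising y ((m N.∸ k) N.+ k)                                 ≈⟨ rising-+ (m N.∸ k) k y ⟩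
    rising y (m N.∸ k) * rising (y + fromℕ (m N.∸ k)) k        ≈⟨ *-congˡ (rising-reflect k _) ⟩
    rising y (m N.∸ k) * (pow (- 1#) k * rising (- ((y + fromℕ (m N.∸ k)) + fromℕ k) + 1#) k)
      ≈⟨ *-congˡ (*-congˡ (rising-cong (+-congʳ (-‿cong (trans (+-assoc _ _ _) (+-congˡ (sym (fromℕ-∸ k≤m)))))) k)) ⟩
    rising y (m N.∸ k) * (pow (- 1#) k * rising (- (y + fromℕ m) + 1#) k) ∎

  hyperTerm : ℕ → Carrier → Carrier → Carrier → ℕ → Carrier
  hyperTerm m b c′ x k = (rising (- fromℕ m) k * rising b k) / (fromℕ (k !) * rising c′ k) * pow x k

  -- _⁻¹ is not assumed to respect ≈, so the lower parameter c′ is related to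
  -- y by an equation instead of being rewritten inside the denominators.
  hyperTerm*rising : ∀ m b y c′ → - (y + fromℕ m) + 1# ≈ c′ → (∀ j → ¬ (c′ + fromℕ j ≈ 0#)) →
    ∀ k → k N.≤ m → hyperTerm m b c′ (- 1#) k * rising y m ≈ fromℕ (m C k) * altRising b k * rising y (m N.∸ k)
  hyperTerm*rising m b y c′ c′≈ c′+j≉0 k k≤m = begin
    A * B / Q * s * rising y m                  ≈⟨ *-congˡ (trans (rising-split-reflect y m k k≤m) (*-congˡ (*-congˡ (rising-cong c′≈ k)))) ⟩
    (A * B) * Q ⁻¹ * s * (R * (s * Rc))
      ≈⟨ solve 6 (λ A B Qi s R Rc → (A :* B) :* Qi :* s :* (R :* (s :* Rc)) := (A :* s) :* (s :* B) :* R :* (Rc :* Qi)) refl A B (Q ⁻¹) s R Rc ⟩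
    (A * s) * (s * B) * R * (Rc * Q ⁻¹)         ≈⟨ *-congʳ (*-congʳ (*-congʳ (rising-neg m k))) ⟩
    (k! * Cm) * (s * B) * R * (Rc * Q ⁻¹)
      ≈⟨ solve 6 (λ k! Cm sB R Rc Qi → (k! :* Cm) :* sB :* R :* (Rc :* Qi) := Cm :* sB :* R :* ((k! :* Rc) :* Qi)) refl k! Cm (s * B) R Rc (Q ⁻¹) ⟩
    Cm * (s * B) * R * (Q * Q ⁻¹)               ≈⟨ *-congˡ (⁻¹-inverse Q (*-≉0 (fromℕ-!≉0 k) (rising≉0 c′ c′+j≉0 k))) ⟩
    Cm * (s * B) * R * 1#                       ≈⟨ *-identityʳ _ ⟩
    Cm * (s * B) * R                            ≈⟨ *-congʳ (*-congˡ (sym (altRising≈pow*rising b k))) ⟩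
    Cm * altRising b k * R                      ∎
    where
    A  = rising (- fromℕ m) k
    B  = rising b k
    k! = fromℕ (k !)
    Rc = rising c′ k
    Q  = k! * Rc
    s  = pow (- 1#) k
    R  = rising y (m N.∸ k)
    Cm = fromℕ (m C k)

  F*rising : ∀ m b y c′ → - (y + fromℕ m) + 1# ≈ c′ → (∀ j → ¬ (c′ + fromℕ j ≈ 0#)) →
             F m b c′ (- 1#) * rising y m ≈ E b y m
  F*rising m b y c′ c′≈ c′+j≉0 = begin
    sumTo m (hyperTerm m b c′ (- 1#)) * rising y m                  ≈⟨ sym (sumTo-*ʳ m _ _) ⟩
    sumTo m (λ k → hyperTerm m b c′ (- 1#) k * rising y m)          ≈⟨ sumTo-cong≤ m (hyperTerm*rising m b y c′ c′≈ c′+j≉0) ⟩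
    sumTo m (λ k → fromℕ (m C k) * altRising b k * rising y (m N.∸ k)) ≈⟨ sym (⊛-binomial m (altRising b) (rising y)) ⟩
    E b y m                                                         ∎

  rising*xPowRising : ∀ i n z → fromℕ (i !) * fromℕ (n C i) * rising z n ≈ rising z i * xPowRising i (z + fromℕ i) n
  rising*xPowRising zero    n z = trans (solve 1 (λ R → (:1 :+ :0) :* (:1 :+ :0) :* R := :1 :* R) refl _)
                                        (*-congˡ (rising-cong (sym (+-identityʳ z)) n))
  rising*xPowRising (suc i) zero    z = trans (*-congʳ (zeroʳ _)) (trans (zeroˡ _) (sym (zeroʳ _)))
  rising*xPowRising (suc i) (suc n) z = begin
    fromℕ (suc i N.* i !) * C′ * rising z (suc n)             ≈⟨ *-cong (*-congʳ (fromℕ-* (suc i) (i !))) (rising-suc z n) ⟩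
    fromℕ (suc i) * i! * C′ * (z * rising (z + 1#) n)
      ≈⟨ solve 5 (λ si i! C′ z R → si :* i! :* C′ :* (z :* R) := i! :* (si :* C′) :* (z :* R)) refl _ _ _ _ _ ⟩
    i! * (fromℕ (suc i) * C′) * (z * rising (z + 1#) n)       ≈⟨ *-congʳ (*-congˡ (fromℕ-C-absorb n i)) ⟩
    i! * (fromℕ (suc n) * fromℕ (n C i)) * (z * rising (z + 1#) n)
      ≈⟨ solve 5 (λ i! sn C z R → i! :* (sn :* C) :* (z :* R) := sn :* z :* (i! :* C :* R)) refl _ _ _ _ _ ⟩
    fromℕ (suc n) * z * (i! * fromℕ (n C i) * rising (z + 1#) n) ≈⟨ *-congˡ (rising*xPowRising i n (z + 1#)) ⟩
    fromℕ (suc n) * z * (rising (z + 1#) i * xPowRising i ((z + 1#) + fromℕ i) n)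
      ≈⟨ solve 4 (λ sn z R X → sn :* z :* (R :* X) := z :* R :* (sn :* X)) refl _ _ _ _ ⟩
    z * rising (z + 1#) i * (fromℕ (suc n) * xPowRising i ((z + 1#) + fromℕ i) n)
      ≈⟨ *-cong (sym (rising-suc z i))
                (*-congˡ (xPowRising-cong i (solve 2 (λ z i → (z :+ :1) :+ i := z :+ (:1 :+ i)) refl z (fromℕ i)) n)) ⟩
    rising z (suc i) * (fromℕ (suc n) * xPowRising i (z + fromℕ (suc i)) n) ∎
    where
    i! = fromℕ (i !)
    C′ = fromℕ (suc n C suc i)

  module _ (b : Carrier) (b∉ℤ : NotInteger b) where

    b+p-q≉0 : ∀ p q → ¬ ((b + fromℕ p) + - fromℕ q ≈ 0#)
    b+p-q≉0 p q b+p-q≈0 with NP.≤-total p q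
    ... | inj₁ p≤q = proj₁ (b∉ℤ (q N.∸ p)) (begin
      b                                 ≈⟨ solve 3 (λ b d p → b := ((b :+ p) :+ :- (d :+ p)) :+ d) refl b _ _ ⟩
      ((b + fromℕ p) + - (fromℕ (q N.∸ p) + fromℕ p)) + fromℕ (q N.∸ p) ≈⟨ +-congʳ (+-congˡ (-‿cong (sym (fromℕ-∸ p≤q)))) ⟩
      ((b + fromℕ p) + - fromℕ q) + fromℕ (q N.∸ p)                     ≈⟨ +-congʳ b+p-q≈0 ⟩
      0# + fromℕ (q N.∸ p)              ≈⟨ +-identityˡ _ ⟩
      fromℕ (q N.∸ p)                   ∎)
    ... | inj₂ q≤p = proj₂ (b∉ℤ (p N.∸ q)) (begin
      b                                 ≈⟨ solve 3 (λ b d q → b := ((b :+ (d :+ q)) :+ :- q) :+ :- d) refl b _ _ ⟩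
      ((b + (fromℕ (p N.∸ q) + fromℕ q)) + - fromℕ q) + - fromℕ (p N.∸ q) ≈⟨ +-congʳ (+-congʳ (+-congˡ (sym (fromℕ-∸ q≤p)))) ⟩
      ((b + fromℕ p) + - fromℕ q) + - fromℕ (p N.∸ q)                     ≈⟨ +-congʳ b+p-q≈0 ⟩
      0# + - fromℕ (p N.∸ q)            ≈⟨ +-identityˡ _ ⟩
      - fromℕ (p N.∸ q)                 ∎)

    y : ℕ → Carrier
    y r = (b + 1#) + - fromℕ (2 N.* r)

    rising-y≉0 : ∀ r m → ¬ (rising (y r) m ≈ 0#)
    rising-y≉0 r = rising≉0 (y r) (λ j e → b+p-q≉0 (suc j) (2 N.* r) (trans
      (solve 3 (λ b j q → (b :+ (:1 :+ j)) :+ :- q := ((b :+ :1) :+ :- q) :+ j) refl b (fromℕ j) (fromℕ (2 N.* r))) e))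

    lhs*rising-y : ∀ r n →
      F (2 N.* n) b ((- fromℕ (2 N.* n) + fromℕ (2 N.* r)) + - b) (- 1#) * rising (y r) (2 N.* n)
      ≈ evenCoeff n * targetSum b r n
    lhs*rising-y r n = begin
      F m b c′ (- 1#) * rising (y r) m      ≈⟨ F*rising m b (y r) c′ c′≈ c′+j≉0 ⟩
      E b (y r) m                           ≡⟨ P.cong₂ (λ t u → E b ((b + 1#) + - fromℕ t) u) (P.sym (double≡2* r)) (P.sym (double≡2* n)) ⟩
      G b (double r) (double n)             ≈⟨ G-double-even b (targetSum b) (targetSum-0 b) (targetSum-1 b) (targetSum-rec b) r n ⟩
      evenCoeff n * targetSum b r n         ∎
      where
      m = 2 N.* n
      c′ = (- fromℕ m + fromℕ (2 N.* r)) + - b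
      c′≈ : - (y r + fromℕ m) + 1# ≈ c′
      c′≈ = solve 3 (λ b q m → :- (((b :+ :1) :+ :- q) :+ m) :+ :1 := (:- m :+ q) :+ :- b) refl b (fromℕ (2 N.* r)) (fromℕ m)
      c′+j≉0 : ∀ j → ¬ (c′ + fromℕ j ≈ 0#)
      c′+j≉0 j e = b+p-q≉0 m (2 N.* r N.+ j) (begin
        (b + fromℕ m) + - fromℕ (2 N.* r N.+ j)              ≈⟨ +-congˡ (-‿cong (fromℕ-+ (2 N.* r) j)) ⟩
        (b + fromℕ m) + - (fromℕ (2 N.* r) + fromℕ j)
          ≈⟨ solve 4 (λ b m q j → (b :+ m) :+ :- (q :+ j) := :- (((:- m :+ q) :+ :- b) :+ j)) refl b (fromℕ m) (fromℕ (2 N.* r)) (fromℕ j) ⟩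
        - (c′ + fromℕ j)                                    ≈⟨ -‿cong e ⟩
        - 0#                                                ≈⟨ -0#≈0# ⟩
        0#                                                  ∎)

    closedSummand : ℕ → ℕ → ℕ → Carrier
    closedSummand r n i = (pow two (2 N.* i) * fromℕ (i !) * fromℕ ((r N.+ i N.∸ 1) C (2 N.* i)))
                          / rising ((b + - fromℕ r) + 1#) i * fromℕ (n C i)

    rising*closedSummand : ∀ r n i →
      rising ((b + 1#) + - fromℕ r) n * closedSummand r n i ≈ coeff r i * basis b r i n
    rising*closedSummand r n i = begin
      rising z n * ((p * i! * Cr) * W ⁻¹ * fromℕ (n C i))
        ≈⟨ solve 6 (λ Rz p i! C Wi nC → Rz :* ((p :* i! :* C) :* Wi :* nC) := p :* C :* ((i! :* nC :* Rz) :* Wi)) refl _ p i! Cr (W ⁻¹) _ ⟩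
      p * Cr * ((i! * fromℕ (n C i) * rising z n) * W ⁻¹)         ≈⟨ *-congˡ (*-congʳ (rising*xPowRising i n z)) ⟩
      p * Cr * ((rising z i * X) * W ⁻¹)                          ≈⟨ *-congˡ (*-congʳ (*-congʳ (rising-cong z≈w i))) ⟩
      p * Cr * ((W * X) * W ⁻¹)
        ≈⟨ solve 5 (λ p C W X Wi → p :* C :* ((W :* X) :* Wi) := p :* C :* X :* (W :* Wi)) refl p Cr W X (W ⁻¹) ⟩
      p * Cr * X * (W * W ⁻¹)                                     ≈⟨ *-congˡ (⁻¹-inverse W W≉0) ⟩
      p * Cr * X * 1#                                             ≈⟨ *-identityʳ _ ⟩
      coeff r i * basis b r i n                                  ∎
      where
      z = (b + 1#) + - fromℕ r
      w = (b + - fromℕ r) + 1#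
      p = pow two (2 N.* i)
      i! = fromℕ (i !)
      Cr = fromℕ ((r N.+ i N.∸ 1) C (2 N.* i))
      W = rising w i
      X = xPowRising i (z + fromℕ i) n
      z≈w : z ≈ w
      z≈w = solve 2 (λ b r → (b :+ :1) :+ :- r := (b :+ :- r) :+ :1) refl b (fromℕ r)
      W≉0 : ¬ (W ≈ 0#)
      W≉0 = rising≉0 w (λ j e → b+p-q≉0 (suc j) r (trans
        (solve 3 (λ b j r → (b :+ (:1 :+ j)) :+ :- r := ((b :+ :- r) :+ :1) :+ j) refl b (fromℕ j) (fromℕ r)) e)) i

    half-shift*two : ∀ R → ((b / two + 1#) + - fromℕ R) * two ≈ y R + 1#
    half-shift*two R = begin
      ((b / two + 1#) + - fromℕ R) * two         ≈⟨ solve 3 (λ h r t → ((h :+ :1) :+ :- r) :* t := h :* t :+ (t :+ :- (r :* t))) refl _ _ two ⟩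
      b / two * two + (two + - (fromℕ R * two))  ≈⟨ +-cong (/two*two b) (+-cong two≈1+1 (-‿cong (fromℕ*two R))) ⟩
      b + ((1# + 1#) + - fromℕ (2 N.* R))        ≈⟨ solve 2 (λ b q → b :+ (:2 :+ :- q) := ((b :+ :1) :+ :- q) :+ :1) refl b _ ⟩
      y R + 1#                                   ∎
      where
      fromℕ*two : ∀ R → fromℕ R * two ≈ fromℕ (2 N.* R)
      fromℕ*two R = trans (*-congˡ two≈1+1) (trans (*-comm _ _) (sym (fromℕ-2* R)))

    half-shift′*two : ∀ R → ((b / two + half) + - fromℕ R) * two ≈ y R
    half-shift′*two R = begin
      ((b / two + half) + - fromℕ R) * two             ≈⟨ solve 4 (λ h ½ r t → ((h :+ ½) :+ :- r) :* t := ((h :+ :1) :+ :- r) :* t :+ (½ :* t :+ :- t)) refl _ half _ two ⟩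
      ((b / two + 1#) + - fromℕ R) * two + (half * two + - two) ≈⟨ +-cong (half-shift*two R) (+-cong half*two≈1 (-‿cong two≈1+1)) ⟩
      (y R + 1#) + (1# + - (1# + 1#))                  ≈⟨ solve 1 (λ y → (y :+ :1) :+ (:1 :+ :- :2) := y) refl _ ⟩
      y R                                              ∎

    rising*closedSum : ∀ r n →
      rising ((b + 1#) + - fromℕ (suc r)) n * sumTo r (closedSummand (suc r) n) ≈ targetSum b (suc r) n
    rising*closedSum r n = begin
      Rz * sumTo r (closedSummand R n)                ≈⟨ sym (sumTo-*ˡ r Rz _) ⟩
      sumTo r (λ i → Rz * closedSummand R n i)        ≈⟨ sumTo-cong r (rising*closedSummand R n) ⟩
      sumTo r (λ i → coeff R i * basis b R i n)       ≈⟨ sym (sumTo-last≈0 r _ (trans (*-congʳ (coeff-vanish R r NP.≤-refl)) (zeroˡ _))) ⟩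
      targetSum b R n                                 ∎
      where
      R = suc r
      Rz = rising ((b + 1#) + - fromℕ R) n

    rhs*rising-y : ∀ r n →
      ((rising half n * rising ((b + 1#) + - fromℕ (suc r)) n)
        / (rising ((b / two + 1#) + - fromℕ (suc r)) n * rising ((b / two + half) + - fromℕ (suc r)) n))
      * sumTo r (closedSummand (suc r) n) * rising (y (suc r)) (2 N.* n)
      ≈ evenCoeff n * targetSum b (suc r) n
    rhs*rising-y r n = begin
      ((H * Rz) * P ⁻¹) * S * D            ≈⟨ *-congˡ (sym 4ⁿP≈D) ⟩
      ((H * Rz) * P ⁻¹) * S * (q * P)
        ≈⟨ solve 6 (λ H Rz Pi S q P → ((H :* Rz) :* Pi) :* S :* (q :* P) := (H :* q) :* (Rz :* S) :* (P :* Pi)) refl H Rz (P ⁻¹) S q P ⟩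
      (H * q) * (Rz * S) * (P * P ⁻¹)      ≈⟨ *-cong (*-cong (rising-half*4^n n) (rising*closedSum r n)) (⁻¹-inverse P P≉0) ⟩
      evenCoeff n * targetSum b R n * 1#   ≈⟨ *-identityʳ _ ⟩
      evenCoeff n * targetSum b R n        ∎
      where
      R = suc r
      H = rising half n
      Rz = rising ((b + 1#) + - fromℕ R) n
      P = rising ((b / two + 1#) + - fromℕ R) n * rising ((b / two + half) + - fromℕ R) n
      S = sumTo r (closedSummand R n)
      D = rising (y R) (2 N.* n)
      q = pow two (2 N.* n)
      4ⁿP≈D : q * P ≈ D
      4ⁿP≈D = rising-duplication (y R) _ _ (half-shift*two R) (half-shift′*two R) n
      P≉0 : ¬ (P ≈ 0#)
      P≉0 P≈0 = rising-y≉0 R (2 N.* n) (trans (sym 4ⁿP≈D) (trans (*-congˡ P≈0) (zeroʳ _)))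

theorem1 : ∀ {c ℓ} (K : CharZeroField c ℓ) →
  let open CharZeroField K
      open FieldOps K
  in (r : ℕ) → r N.≥ 1 → (n : ℕ) → (b : Carrier) → NotInteger b →
     F (2 N.* n) b ((- fromℕ (2 N.* n) + fromℕ (2 N.* r)) + - b) (- 1#)
     ≈ ((rising half n * rising ((b + 1#) + - fromℕ r) n)
         / (rising ((b / two + 1#) + - fromℕ r) n
            * rising ((b / two + half) + - fromℕ r) n))
       * sumTo (r N.∸ 1) (λ i →
           (pow two (2 N.* i) * fromℕ (i !) * fromℕ ((r N.+ i N.∸ 1) C (2 N.* i)))
           / rising ((b + - fromℕ r) + 1#) i
           * fromℕ (n C i))
theorem1 K (suc r) _ n b b∉ℤ =
  *-cancelʳ K (rising-y≉0 K b b∉ℤ (suc r) (2 N.* n))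
    (CharZeroField.trans K (lhs*rising-y K b b∉ℤ (suc r) n)
                           (CharZeroField.sym K (rhs*rising-y K b b∉ℤ r n)))
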